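{- Let $\sigma\in S_n$ have cycle decomposition $\sigma=\sigma_1\cdots\sigma_m$ (fixed points included as $1$-cycles, each cycle identified with its set of elements), and label the facets of $\mathrm{SEP}(K_n)$ by nonempty proper subsets of $[n]$, the facet labeled $S$ being $\mathrm{SEP}(K_n)\cap\{\mathbf{x}:\mathbf{e}_S^\top\mathbf{x}=1\}$. Then $\mathrm{SEP}(K_n)^\sigma$ has exactly $2^m-2$ facets, and each facet of $\mathrm{SEP}(K_n)^\sigma$ is contained in a distinct facet of $\mathrm{SEP}(K_n)$ whose label $S$ satisfies, for each $k\in[m]$, either $S\cap\sigma_k=\emptyset$ or $S\cap\sigma_k=\sigma_k$.
   Context: $\mathrm{SEP}(K_n)=\operatorname{conv}\{\mathbf{e}_i-\mathbf{e}_j\in\mathbb{R}^n:i\neq j\}$ is an $(n-1)$-dimensional polytope in $\{\mathbf{x}:\mathbf{1}^\top\mathbf{x}=0\}$ whose facets are exactly the $2^n-2$ faces $\mathrm{SEP}(K_n)\cap\{\mathbf{e}_S^\top\mathbf{x}=1\}$ for nonempty proper $S\subset[n]$; $\mathbf{e}_S=\sum_{i\in S}\mathbf{e}_i$, $\mathbf{1}=\mathbf{e}_{[n]}$. $S_n$ acts on $\mathbb{R}^n$ by $\sigma\cdot\mathbf{e}_i=\mathbf{e}_{\sigma(i)}$ and $P^\sigma=\{\mathbf{x}\in P:\sigma\cdot\mathbf{x}=\mathbf{x}\}$. -}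

module Defs where

open import Level using (0ℓ)
open import Data.Nat as ℕ using (ℕ; zero; suc)
open import Data.Fin using (Fin; zero; suc)
open import Data.Fin.Subset using (Subset; _∈_; _∉_; Nonempty)
open import Data.Fin.Permutation using (Permutation′; _⟨$⟩ʳ_; _⟨$⟩ˡ_)
open import Data.Rational using (ℚ; 0ℚ; 1ℚ; _+_; _*_; _-_; _≤_)
open import Data.Bool using (Bool; true; false; if_then_else_)
open import Data.Vec using (lookup)
open import Data.Product using (Σ; ∃; _×_; _,_)
open import Data.Sum using (_⊎_)
open import Relation.Nullary using (¬_; yes; no)
open import Relation.Binary.PropositionalEquality using (_≡_; _≢_)
import Data.Fin as F

Point : ℕ → Set
Point n = Fin n → ℚ

∑ : ∀ {k} → (Fin k → ℚ) → ℚ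
∑ {zero}  f = 0ℚ
∑ {suc k} f = f zero + ∑ (λ i → f (suc i))

_·_ : ∀ {n} → Point n → Point n → ℚ
a · x = ∑ (λ i → a i * x i)

𝐞 : ∀ {n} → Fin n → Point n
𝐞 i j with i F.≟ j
... | yes _ = 1ℚ
... | no  _ = 0ℚ

𝐞[_] : ∀ {n} → Subset n → Point n
𝐞[ S ] i = if lookup S i then 1ℚ else 0ℚ

PSet : ℕ → Set₁
PSet n = Point n → Set

_⊆ₚ_ : ∀ {n} → PSet n → PSet n → Set
A ⊆ₚ B = ∀ x → A x → B x

_≐_ : ∀ {n} → PSet n → PSet n → Set
A ≐ B = A ⊆ₚ B × B ⊆ₚ A

-- SEP(K_n) = conv{ e_i - e_j : i ≠ j }, as convex combinations with
-- weights w i j on the pairs (i,j), i ≠ j.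
SEP : (n : ℕ) → PSet n
SEP n x = Σ (Fin n → Fin n → ℚ) λ w →
    (∀ i j → 0ℚ ≤ w i j)
  × (∀ i → w i i ≡ 0ℚ)
  × (∑ (λ i → ∑ (λ j → w i j)) ≡ 1ℚ)
  × (∀ k → x k ≡ ∑ (λ i → ∑ (λ j → w i j * (𝐞 i k - 𝐞 j k))))

-- Action of S_n: σ·e_i = e_{σ(i)}, i.e. (σ·x)_j = x_{σ⁻¹(j)}.
act : ∀ {n} → Permutation′ n → Point n → Point n
act σ x j = x (σ ⟨$⟩ˡ j)

Fixed : ∀ {n} → Permutation′ n → PSet n → PSet n
Fixed σ P x = P x × (∀ j → act σ x j ≡ x j)

SEPFacet : (n : ℕ) → Subset n → PSet n
SEPFacet n S x = SEP n x × (𝐞[ S ] · x ≡ 1ℚ)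

AffInd : ∀ {n k} → (Fin k → Point n) → Set
AffInd {n} {k} p = ∀ (λ' : Fin k → ℚ) →
  ∑ λ' ≡ 0ℚ → (∀ c → ∑ (λ i → λ' i * p i c) ≡ 0ℚ) → ∀ i → λ' i ≡ 0ℚ

-- A has exactly k affinely independent points at most, i.e. dim A = k - 1.
AffDimPlus1 : ∀ {n} → PSet n → ℕ → Set
AffDimPlus1 {n} A k =
    (Σ (Fin k → Point n) λ p → (∀ i → A (p i)) × AffInd p)
  × (∀ (p : Fin (suc k) → Point n) → (∀ i → A (p i)) → ¬ AffInd p)

IsFace : ∀ {n} → PSet n → PSet n → Set
IsFace {n} P F = Σ (Point n) λ a → Σ ℚ λ b →
    (∀ x → P x → a · x ≤ b)
  × (F ≐ (λ x → P x × (a · x ≡ b)))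

IsFacet : ∀ {n} → PSet n → PSet n → Set
IsFacet P F = IsFace P F × (∃ λ x → F x) ×
  (Σ ℕ λ k → AffDimPlus1 P (suc k) × AffDimPlus1 F k)

σ^ : ∀ {n} → Permutation′ n → ℕ → Fin n → Fin n
σ^ σ zero i = i
σ^ σ (suc k) i = σ ⟨$⟩ʳ (σ^ σ k i)

-- c : Fin n → Fin m is a cycle decomposition of σ into m cycles:
-- cycle t is the set c⁻¹(t); cycles are exactly the σ-orbits, all nonempty.
IsCycleDecomp : ∀ {n m} → Permutation′ n → (Fin n → Fin m) → Set
IsCycleDecomp {n} {m} σ c =
    (∀ t → ∃ λ i → c i ≡ t)
  × (∀ i j → c i ≡ c j → ∃ λ k → σ^ σ k i ≡ j)
  × (∀ i k → c (σ^ σ k i) ≡ c i)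

CycleUnion : ∀ {n m} → (Fin n → Fin m) → Subset n → Set
CycleUnion {n} {m} c S = ∀ (t : Fin m) →
  (∀ i → c i ≡ t → i ∉ S) ⊎ (∀ i → c i ≡ t → i ∈ S)

NonemptyProper : ∀ {n} → Subset n → Set
NonemptyProper S = Nonempty S × (∃ λ i → i ∉ S)

{-# OPTIONS --safe #-}
module Submission where

open import Defs

-- A σ-invariant point is constant on the cycles of σ, so P = SEP(Kₙ)^σ lives in an
-- (m - 1)-dimensional space and contains the arcs b_s - b_t between the barycentres of the
-- cycles. A valid inequality a · x ≤ b of P may be replaced by its average ā over the cycles;
-- on P the value of ā · x is at most max ā - min ā, with equality exactly for the flows from
-- cycles where ā is maximal to cycles where it is minimal. For a facet, a third value of ā
-- would confine the facet to a hyperplane xᵢ = 0 and cost a dimension, so the facet is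
-- P ∩ {e_S · x = 1} where S is the union of the cycles on which ā is maximal. Conversely each
-- nonempty proper union S of cycles gives a facet, spanned by m - 1 independent arcs, and
-- distinct unions give distinct facets: there are 2^m - 2 of them.

-- The development gets a block of its own so that the order on ℚ, imported here as _≤_,
-- does not clash with the order on ℕ in the statement of the theorem.
module _ where

  open import Level using (0ℓ)
  open import Algebra.Bundles using (CommutativeRing)
  open import Data.Nat as ℕ using (ℕ; zero; suc; _^_; _∸_; _≤′_; ≤′-refl; ≤′-step)
  import Data.Nat.Properties as ℕ
  open import Data.Fin as Fin using (Fin; zero; suc; punchIn; punchOut; cast; combine; funToFin; finToFun)
  open import Data.Fin.Properties
    using (2↔Bool; any?; punchInᵢ≢i; punchIn-punchOut; punchIn-injective; punchOut-injective; cast-involutive;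
           funToFin-finToFin; finToFun-funToFin)
  open import Data.Fin.Permutation using (Permutation′; _⟨$⟩ʳ_; _⟨$⟩ˡ_; inverseˡ; inverseʳ)
  open import Data.Fin.Subset using (Subset; _∈_; _∉_; _⊆_) renaming (⊥ to ∅; ⊤ to full)
  open import Data.Fin.Subset.Properties using (_∈?_; nonempty?; Empty-unique; ⊆-antisym; ⊆-max; ∉⊥; ∈⊤)
  open import Data.Rational as ℚ using (ℚ; 0ℚ; 1ℚ; _+_; _*_; _-_; -_; 1/_; _≤_; _<_; NonZero)
  import Data.Rational.Properties as ℚ
  open import Data.Bool using (Bool; true; false; if_then_else_)
  open import Data.List using (allFin)
  open import Data.List.Membership.Propositional.Properties using (∈-allFin)
  import Data.List.Relation.Unary.All as All
  open import Data.Vec using (lookup; tabulate)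
  open import Data.Vec.Properties using (lookup∘tabulate; tabulate∘lookup; tabulate-cong; []=⇒lookup; lookup⇒[]=)
  open import Data.Vec.Functional using (_∷_; insertAt)
  open import Data.Vec.Functional.Properties using (insertAt-lookup; insertAt-punchIn)
  open import Data.Product using (Σ; ∃; _×_; _,_; proj₁; proj₂)
  open import Data.Sum using (_⊎_; inj₁; inj₂; [_,_]′; map₂)
  open import Data.Empty using (⊥; ⊥-elim)
  open import Function using (_∘_; flip; Inverse)
  open import Relation.Nullary using (¬_; ¬?; Dec; yes; no; does)
  open import Relation.Nullary.Decidable using (dec-true; decidable-stable; dec⇒maybe)
  open import Relation.Unary using (Pred; Decidable)
  open import Relation.Binary using (tri<; tri≈; tri>)
  open import Relation.Binary.Bundles using (DecTotalOrder)
  open import Relation.Binary.PropositionalEquality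
  open import Data.List.Extrema (DecTotalOrder.totalOrder ℚ.≤-decTotalOrder) using (argmax; argmin; f[xs]≤f[argmax]; f[argmin]≤f[xs])
  open import Algebra.Properties.Group ℚ.+-0-group using (inverseʳ-unique; x∙y⁻¹≈ε⇒x≈y) renaming (∙-cancelˡ to +-cancelˡ)
  import Algebra.Properties.Semiring.Sum (CommutativeRing.semiring ℚ.+-*-commutativeRing) as Sum
  open import Tactic.RingSolver using (solve-∀)
  open import Tactic.RingSolver.Core.AlmostCommutativeRing using (AlmostCommutativeRing; fromCommutativeRing)

  -- The solver needs a genuine zero test on coefficients; with λ _ → nothing it cannot
  -- cancel opposite monomials.
  ℚ-ring : AlmostCommutativeRing _ _
  ℚ-ring = fromCommutativeRing ℚ.+-*-commutativeRing (λ x → dec⇒maybe (0ℚ ℚ.≟ x))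

  *-distribˡ-- : ∀ w a b → w * (a - b) ≡ w * a - w * b
  *-distribˡ-- = solve-∀ ℚ-ring

  0*x+y≡y : ∀ x y → 0ℚ * x + y ≡ y
  0*x+y≡y = solve-∀ ℚ-ring

  +-mono-≤-≡ : ∀ {a b c d} → a ≤ b → c ≤ d → a + c ≡ b + d → a ≡ b × c ≡ d
  +-mono-≤-≡ {a} {b} {c} {d} a≤b c≤d a+c≡b+d with ℚ.<-cmp a b
  ... | tri< a<b _ _ = ⊥-elim (ℚ.<-irrefl a+c≡b+d (ℚ.+-mono-<-≤ a<b c≤d))
  ... | tri≈ _ refl _ = refl , +-cancelˡ a c d a+c≡b+d
  ... | tri> _ _ b<a = ⊥-elim (ℚ.<-irrefl refl (ℚ.<-≤-trans b<a a≤b))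

  *-cancelˡ-≢0 : ∀ {a} x y → a ≢ 0ℚ → a * x ≡ a * y → x ≡ y
  *-cancelˡ-≢0 {a} x y a≢0 ax≡ay = begin
    x                ≡⟨ lemma x ⟨
    1/ a * (a * x)   ≡⟨ cong (1/ a *_) ax≡ay ⟩
    1/ a * (a * y)   ≡⟨ lemma y ⟩
    y                ∎
    where
    open ≡-Reasoning
    instance _ = ℚ.≢-nonZero a≢0
    lemma : ∀ z → 1/ a * (a * z) ≡ z
    lemma z = trans (sym (ℚ.*-assoc (1/ a) a z))
                    (trans (cong (_* z) (ℚ.*-inverseˡ a)) (ℚ.*-identityˡ z))

  x*y≡0⇒y≡0 : ∀ {x y} → x ≢ 0ℚ → x * y ≡ 0ℚ → y ≡ 0ℚ
  x*y≡0⇒y≡0 {x} {y} x≢0 xy≡0 = *-cancelˡ-≢0 y 0ℚ x≢0 (trans xy≡0 (sym (ℚ.*-zeroʳ x)))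

  x*y≡0⇒x≡0 : ∀ {x y} → y ≢ 0ℚ → x * y ≡ 0ℚ → x ≡ 0ℚ
  x*y≡0⇒x≡0 {x} {y} y≢0 xy≡0 = x*y≡0⇒y≡0 y≢0 (trans (ℚ.*-comm y x) xy≡0)

  *-nonNeg : ∀ {a b} → 0ℚ ≤ a → 0ℚ ≤ b → 0ℚ ≤ a * b
  *-nonNeg {a} {b} a≥0 b≥0 = ℚ.nonNegative⁻¹ (a * b)
    {{ℚ.nonNeg*nonNeg⇒nonNeg a {{ℚ.nonNegative a≥0}} b {{ℚ.nonNegative b≥0}}}}

  *-monoˡ-≤-nonNeg′ : ∀ {w x y} → 0ℚ ≤ w → x ≤ y → w * x ≤ w * y
  *-monoˡ-≤-nonNeg′ {w} w≥0 = ℚ.*-monoˡ-≤-nonNeg w {{ℚ.nonNegative w≥0}}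

  ∑≡sum : ∀ {k} (f : Fin k → ℚ) → ∑ f ≡ Sum.sum f
  ∑≡sum {zero}  f = refl
  ∑≡sum {suc k} f = cong (f zero +_) (∑≡sum (f ∘ suc))

  ∑-cong : ∀ {k} {f g : Fin k → ℚ} → (∀ i → f i ≡ g i) → ∑ f ≡ ∑ g
  ∑-cong {f = f} {g} f≗g
    rewrite ∑≡sum f | ∑≡sum g = Sum.sum-cong-≗ f≗g

  ∑-zero : ∀ k → ∑ {k} (λ _ → 0ℚ) ≡ 0ℚ
  ∑-zero k rewrite ∑≡sum {k} (λ _ → 0ℚ) = Sum.sum-replicate-zero k

  ∑-distrib-+ : ∀ {k} (f g : Fin k → ℚ) → ∑ (λ i → f i + g i) ≡ ∑ f + ∑ g
  ∑-distrib-+ f g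
    rewrite ∑≡sum (λ i → f i + g i) | ∑≡sum f | ∑≡sum g = Sum.∑-distrib-+ f g

  *-distribˡ-∑ : ∀ {k} a (f : Fin k → ℚ) → a * ∑ f ≡ ∑ (λ i → a * f i)
  *-distribˡ-∑ a f
    rewrite ∑≡sum f | ∑≡sum (λ i → a * f i) = Sum.*-distribˡ-sum a f

  *-distribʳ-∑ : ∀ {k} a (f : Fin k → ℚ) → ∑ f * a ≡ ∑ (λ i → f i * a)
  *-distribʳ-∑ a f
    rewrite ∑≡sum f | ∑≡sum (λ i → f i * a) = Sum.*-distribʳ-sum a f

  ∑-remove : ∀ {k} (f : Fin (suc k) → ℚ) j → ∑ f ≡ f j + ∑ (f ∘ punchIn j)
  ∑-remove f j
    rewrite ∑≡sum f | ∑≡sum (f ∘ punchIn j) = Sum.sum-remove {i = j} f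

  ∑-comm : ∀ {k l} (f : Fin k → Fin l → ℚ) →
           ∑ (λ i → ∑ (λ j → f i j)) ≡ ∑ (λ j → ∑ (λ i → f i j))
  ∑-comm f = begin
    ∑ (λ i → ∑ (f i))                      ≡⟨ ∑∑≡sum∑ f ⟩
    Sum.sum (λ i → Sum.sum (f i))          ≡⟨ Sum.∑-comm f ⟩
    Sum.sum (λ j → Sum.sum (λ i → f i j))  ≡⟨ ∑∑≡sum∑ (flip f) ⟨
    ∑ (λ j → ∑ (λ i → f i j))              ∎
    where
    open ≡-Reasoning
    ∑∑≡sum∑ : ∀ {k l} (g : Fin k → Fin l → ℚ) → ∑ (λ i → ∑ (g i)) ≡ Sum.sum (λ i → Sum.sum (g i))
    ∑∑≡sum∑ g = trans (∑-cong (∑≡sum ∘ g)) (∑≡sum (λ i → Sum.sum (g i)))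

  ∑-neg : ∀ {k} (f : Fin k → ℚ) → ∑ (λ i → - f i) ≡ - ∑ f
  ∑-neg {zero}  f = refl
  ∑-neg {suc k} f = trans (cong (- f zero +_) (∑-neg (f ∘ suc))) (sym (ℚ.neg-distrib-+ (f zero) _))

  ∑-distrib-- : ∀ {k} (f g : Fin k → ℚ) → ∑ (λ i → f i - g i) ≡ ∑ f - ∑ g
  ∑-distrib-- f g = trans (∑-distrib-+ f (λ i → - g i)) (cong (∑ f +_) (∑-neg g))

  ∑-single : ∀ {k} (f : Fin k → ℚ) j → (∀ i → i ≢ j → f i ≡ 0ℚ) → ∑ f ≡ f j
  ∑-single {suc k} f j f≡0 = begin
    ∑ f                           ≡⟨ ∑-remove f j ⟩
    f j + ∑ (f ∘ punchIn j)       ≡⟨ cong (f j +_) (∑-cong (λ i → f≡0 _ (punchInᵢ≢i j i))) ⟩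
    f j + ∑ {k} (λ _ → 0ℚ)        ≡⟨ cong (f j +_) (∑-zero k) ⟩
    f j + 0ℚ                      ≡⟨ ℚ.+-identityʳ (f j) ⟩
    f j                           ∎
    where open ≡-Reasoning

  ∑-mono-≤ : ∀ {k} {f g : Fin k → ℚ} → (∀ i → f i ≤ g i) → ∑ f ≤ ∑ g
  ∑-mono-≤ {zero}  f≤g = ℚ.≤-refl
  ∑-mono-≤ {suc k} f≤g = ℚ.+-mono-≤ (f≤g zero) (∑-mono-≤ (f≤g ∘ suc))

  ∑-nonNeg : ∀ {k} {f : Fin k → ℚ} → (∀ i → 0ℚ ≤ f i) → 0ℚ ≤ ∑ f
  ∑-nonNeg {k} {f} f≥0 = subst (_≤ ∑ f) (∑-zero k) (∑-mono-≤ f≥0)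

  term≤∑ : ∀ {k} {f : Fin k → ℚ} → (∀ i → 0ℚ ≤ f i) → ∀ j → f j ≤ ∑ f
  term≤∑ {suc k} {f} f≥0 j = begin
    f j                         ≡⟨ ℚ.+-identityʳ (f j) ⟨
    f j + 0ℚ                    ≤⟨ ℚ.+-monoʳ-≤ (f j) (∑-nonNeg (f≥0 ∘ punchIn j)) ⟩
    f j + ∑ (f ∘ punchIn j)     ≡⟨ ∑-remove f j ⟨
    ∑ f                         ∎
    where open ℚ.≤-Reasoning

  ∑-mono-≤-≡ : ∀ {k} {f g : Fin k → ℚ} → (∀ i → f i ≤ g i) → ∑ f ≡ ∑ g → ∀ i → f i ≡ g i
  ∑-mono-≤-≡ {suc k} {f} {g} f≤g ∑f≡∑g i =
    proj₁ (+-mono-≤-≡ (f≤g i) (∑-mono-≤ (f≤g ∘ punchIn i))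
                      (trans (sym (∑-remove f i)) (trans ∑f≡∑g (∑-remove g i))))

  IsDependence : ∀ {k d} → (Fin k → Fin d → ℚ) → (Fin k → ℚ) → Set
  IsDependence v μ = (∃ λ i → μ i ≢ 0ℚ) × (∀ l → ∑ (λ i → μ i * v i l) ≡ 0ℚ)

  dependence-zeroColumn : ∀ {k d} (v : Fin (suc k) → Fin (suc d) → ℚ) → (∀ i → v i zero ≡ 0ℚ) →
                          ∃ (IsDependence (λ i l → v (suc i) (suc l))) → ∃ (IsDependence v)
  dependence-zeroColumn {k} v v≡0 (μ , (i , μi≢0) , μv≡0) = (0ℚ ∷ μ) , (suc i , μi≢0) , λ where
    zero    → trans (0*x+y≡y (v zero zero) _)
                    (trans (∑-cong (λ i → trans (cong (μ i *_) (v≡0 (suc i))) (ℚ.*-zeroʳ (μ i)))) (∑-zero k))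
    (suc l) → trans (0*x+y≡y (v zero (suc l)) _) (μv≡0 l)

  -- Gaussian elimination on the first column, pivoting on row j.
  module Pivot {k d} (v : Fin (suc k) → Fin (suc d) → ℚ) (j : Fin (suc k)) (vj≢0 : v j zero ≢ 0ℚ) where
    instance _ = ℚ.≢-nonZero vj≢0

    ρ : Fin k → ℚ
    ρ i = v (punchIn j i) zero * 1/ v j zero

    reduced : Fin k → Fin (suc d) → ℚ
    reduced i l = v (punchIn j i) l - ρ i * v j l

    reduced-zero : ∀ i → reduced i zero ≡ 0ℚ
    reduced-zero i = begin
      a - a * 1/ p * p     ≡⟨ cong (λ z → a - z) (ℚ.*-assoc a (1/ p) p) ⟩
      a - a * (1/ p * p)   ≡⟨ cong (λ z → a - a * z) (ℚ.*-inverseˡ p) ⟩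
      a - a * 1ℚ           ≡⟨ cong (λ z → a - z) (ℚ.*-identityʳ a) ⟩
      a - a                ≡⟨ ℚ.+-inverseʳ a ⟩
      0ℚ                   ∎
      where
      open ≡-Reasoning
      a = v (punchIn j i) zero
      p = v j zero

    module _ (μ : Fin k → ℚ) where
      lifted : Fin (suc k) → ℚ
      lifted = insertAt μ j (- ∑ (λ i → μ i * ρ i))

      lifted-combination : ∀ l → ∑ (λ i → lifted i * v i l) ≡ ∑ (λ i → μ i * reduced i l)
      lifted-combination l = begin
        ∑ (λ i → lifted i * v i l)
          ≡⟨ ∑-remove (λ i → lifted i * v i l) j ⟩
        lifted j * v j l + ∑ (λ i → lifted (punchIn j i) * v (punchIn j i) l)
          ≡⟨ cong₂ _+_ (cong (_* v j l) (insertAt-lookup μ j _))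
                       (∑-cong (λ i → cong (_* v (punchIn j i) l) (insertAt-punchIn μ j _ i))) ⟩
        - S * v j l + ∑ (λ i → μ i * v (punchIn j i) l)
          ≡⟨ cong (- S * v j l +_) (∑-cong (λ i → split (μ i) (v (punchIn j i) l) (ρ i) (v j l))) ⟩
        - S * v j l + ∑ (λ i → μ i * reduced i l + μ i * ρ i * v j l)
          ≡⟨ cong (- S * v j l +_) (∑-distrib-+ (λ i → μ i * reduced i l) (λ i → μ i * ρ i * v j l)) ⟩
        - S * v j l + (R + ∑ (λ i → μ i * ρ i * v j l))
          ≡⟨ cong (λ z → - S * v j l + (R + z)) (*-distribʳ-∑ (v j l) (λ i → μ i * ρ i)) ⟨
        - S * v j l + (R + S * v j l)
          ≡⟨ cancel S (v j l) R ⟩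
        R ∎
        where
        open ≡-Reasoning
        S = ∑ (λ i → μ i * ρ i)
        R = ∑ (λ i → μ i * reduced i l)
        split : ∀ m a q b → m * a ≡ m * (a - q * b) + m * q * b
        split = solve-∀ ℚ-ring
        cancel : ∀ s b r → - s * b + (r + s * b) ≡ r
        cancel = solve-∀ ℚ-ring

    lift : ∃ (IsDependence (λ i l → reduced i (suc l))) → ∃ (IsDependence v)
    lift (μ , (i , μi≢0) , μv≡0) =
      lifted μ ,
      (punchIn j i , subst (_≢ 0ℚ) (sym (insertAt-punchIn μ j _ i)) μi≢0) ,
      λ l → trans (lifted-combination μ l) (reducedCombination l)
      where
      reducedCombination : ∀ l → ∑ (λ i → μ i * reduced i l) ≡ 0ℚ
      reducedCombination zero    = trans (∑-cong (λ i → trans (cong (μ i *_) (reduced-zero i)) (ℚ.*-zeroʳ (μ i)))) (∑-zero k)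
      reducedCombination (suc l) = μv≡0 l

  dependence : ∀ d (v : Fin (suc d) → Fin d → ℚ) → ∃ (IsDependence v)
  dependence zero    v = (λ _ → 1ℚ) , (zero , λ ()) , λ ()
  dependence (suc d) v with any? (λ i → ¬? (v i zero ℚ.≟ 0ℚ))
  ... | yes (j , vj≢0) = Pivot.lift v j vj≢0 (dependence d (λ i l → Pivot.reduced v j vj≢0 i (suc l)))
  ... | no  ∄         = dependence-zeroColumn v v≡0 (dependence d (λ i l → v (suc i) (suc l)))
    where
    v≡0 : ∀ i → v i zero ≡ 0ℚ
    v≡0 i = decidable-stable (v i zero ℚ.≟ 0ℚ) (λ vi≢0 → ∄ (i , vi≢0))

  module _ {k : ℕ} where

    𝐞-diag : (i : Fin k) → 𝐞 i i ≡ 1ℚ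
    𝐞-diag i with i Fin.≟ i
    ... | yes _   = refl
    ... | no i≢i = ⊥-elim (i≢i refl)

    𝐞-offDiag : {i j : Fin k} → i ≢ j → 𝐞 i j ≡ 0ℚ
    𝐞-offDiag {i} {j} i≢j with i Fin.≟ j
    ... | yes i≡j = ⊥-elim (i≢j i≡j)
    ... | no _    = refl

    𝐞-nonNeg : (i j : Fin k) → 0ℚ ≤ 𝐞 i j
    𝐞-nonNeg i j with i Fin.≟ j
    ... | yes _ = ℚ.nonNegative⁻¹ 1ℚ
    ... | no _  = ℚ.≤-refl

    𝐞-disjoint : {s t : Fin k} → s ≢ t → ∀ u → 𝐞 u s * 𝐞 u t ≡ 0ℚ
    𝐞-disjoint {s} {t} s≢t u = byCases (u Fin.≟ s)
      where
      byCases : Dec (u ≡ s) → 𝐞 u s * 𝐞 u t ≡ 0ℚ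
      byCases (yes refl) = trans (cong (𝐞 u s *_) (𝐞-offDiag s≢t)) (ℚ.*-zeroʳ (𝐞 u s))
      byCases (no u≢s)   = trans (cong (_* 𝐞 u t) (𝐞-offDiag u≢s)) (ℚ.*-zeroˡ (𝐞 u t))

    𝐞-subst : (s t : Fin k) (h : Fin k → ℚ) → 𝐞 s t * h s ≡ 𝐞 s t * h t
    𝐞-subst s t h with s Fin.≟ t
    ... | yes refl = refl
    ... | no _     = trans (ℚ.*-zeroˡ (h s)) (sym (ℚ.*-zeroˡ (h t)))

    ∑-*𝐞 : (s : Fin k) (h : Fin k → ℚ) → ∑ (λ t → h t * 𝐞 t s) ≡ h s
    ∑-*𝐞 s h = trans (∑-single (λ t → h t * 𝐞 t s) s
                       (λ t t≢s → trans (cong (h t *_) (𝐞-offDiag t≢s)) (ℚ.*-zeroʳ (h t))))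
                     (trans (cong (h s *_) (𝐞-diag s)) (ℚ.*-identityʳ (h s)))

    ·-𝐞 : (s : Fin k) (y : Point k) → 𝐞 s · y ≡ y s
    ·-𝐞 s y = trans (∑-single (λ t → 𝐞 s t * y t) s
                      (λ t t≢s → trans (cong (_* y t) (𝐞-offDiag (t≢s ∘ sym))) (ℚ.*-zeroˡ (y t))))
                    (trans (cong (_* y s) (𝐞-diag s)) (ℚ.*-identityˡ (y s)))

  indicator : Bool → ℚ
  indicator b = if b then 1ℚ else 0ℚ

  indicator-gap≤1 : ∀ b b′ → indicator b - indicator b′ ≤ 1ℚ
  indicator-gap≤1 true  true  = ℚ.nonNegative⁻¹ 1ℚ
  indicator-gap≤1 true  false = ℚ.≤-refl
  indicator-gap≤1 false true  = ℚ.<⇒≤ (ℚ.<-trans (ℚ.negative⁻¹ (- 1ℚ)) (ℚ.positive⁻¹ 1ℚ))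
  indicator-gap≤1 false false = ℚ.nonNegative⁻¹ 1ℚ

  indicator-gap≡1 : ∀ b b′ → indicator b - indicator b′ ≡ 1ℚ → b ≡ true × b′ ≡ false
  indicator-gap≡1 true  false _ = refl , refl
  indicator-gap≡1 true  true  ()
  indicator-gap≡1 false true  ()
  indicator-gap≡1 false false ()

  module _ {k : ℕ} (S : Subset k) where

    𝐞[]-gap≤1 : ∀ i j → 𝐞[ S ] i - 𝐞[ S ] j ≤ 1ℚ
    𝐞[]-gap≤1 i j = indicator-gap≤1 (lookup S i) (lookup S j)

    𝐞[]-gap≡1⇒∈∉ : ∀ {i j} → 𝐞[ S ] i - 𝐞[ S ] j ≡ 1ℚ → i ∈ S × j ∉ S
    𝐞[]-gap≡1⇒∈∉ {i} {j} gap≡1 with indicator-gap≡1 (lookup S i) (lookup S j) gap≡1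
    ... | Si≡true , Sj≡false = lookup⇒[]= i S Si≡true , λ j∈S → true≢false (trans (sym ([]=⇒lookup j∈S)) Sj≡false)
      where
      true≢false : true ≢ false
      true≢false ()

    ∈∉⇒𝐞[]-gap≡1 : ∀ {i j} → i ∈ S → j ∉ S → 𝐞[ S ] i - 𝐞[ S ] j ≡ 1ℚ
    ∈∉⇒𝐞[]-gap≡1 {i} {j} i∈S j∉S with lookup S j in Sj
    ... | true  = ⊥-elim (j∉S (lookup⇒[]= j S Sj))
    ... | false = cong (λ b → indicator b - 0ℚ) ([]=⇒lookup i∈S)

  module _ {n : ℕ} where

    Weights : Set
    Weights = Fin n → Fin n → ℚ

    Represents : Point n → Weights → Set
    Represents x w = ∀ k → x k ≡ ∑ (λ i → ∑ (λ j → w i j * (𝐞 i k - 𝐞 j k)))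

    weights : ∀ {x} → SEP n x → Weights
    weights = proj₁

    weights-nonNeg : ∀ {x} (s : SEP n x) → ∀ i j → 0ℚ ≤ weights s i j
    weights-nonNeg s = proj₁ (proj₂ s)

    weights-sum : ∀ {x} (s : SEP n x) → ∑ (λ i → ∑ (λ j → weights s i j)) ≡ 1ℚ
    weights-sum s = proj₁ (proj₂ (proj₂ (proj₂ s)))

    represents : ∀ {x} (s : SEP n x) → Represents x (weights s)
    represents s = proj₂ (proj₂ (proj₂ (proj₂ s)))

    netFlow : (w : Weights) (k : Fin n) →
              ∑ (λ i → ∑ (λ j → w i j * (𝐞 i k - 𝐞 j k))) ≡ ∑ (λ j → w k j) - ∑ (λ i → w i k)
    netFlow w k = begin
      ∑ (λ i → ∑ (λ j → w i j * (𝐞 i k - 𝐞 j k)))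
        ≡⟨ ∑-cong (λ i → trans (∑-cong (λ j → *-distribˡ-- (w i j) (𝐞 i k) (𝐞 j k)))
                                (∑-distrib-- (λ j → w i j * 𝐞 i k) (λ j → w i j * 𝐞 j k))) ⟩
      ∑ (λ i → ∑ (λ j → w i j * 𝐞 i k) - ∑ (λ j → w i j * 𝐞 j k))
        ≡⟨ ∑-distrib-- (λ i → ∑ (λ j → w i j * 𝐞 i k)) (λ i → ∑ (λ j → w i j * 𝐞 j k)) ⟩
      ∑ (λ i → ∑ (λ j → w i j * 𝐞 i k)) - ∑ (λ i → ∑ (λ j → w i j * 𝐞 j k))
        ≡⟨ cong₂ _-_ outflow inflow ⟩
      ∑ (λ j → w k j) - ∑ (λ i → w i k) ∎
      where
      open ≡-Reasoning
      outflow : ∑ (λ i → ∑ (λ j → w i j * 𝐞 i k)) ≡ ∑ (λ j → w k j)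
      outflow = trans (∑-cong (λ i → sym (*-distribʳ-∑ (𝐞 i k) (w i)))) (∑-*𝐞 k (λ i → ∑ (w i)))
      inflow : ∑ (λ i → ∑ (λ j → w i j * 𝐞 j k)) ≡ ∑ (λ i → w i k)
      inflow = ∑-cong (λ i → ∑-*𝐞 k (w i))

    ·-flow : (a x : Point n) (w : Weights) → Represents x w →
             a · x ≡ ∑ (λ i → ∑ (λ j → w i j * (a i - a j)))
    ·-flow a x w x≡flow = begin
      ∑ (λ k → a k * x k)
        ≡⟨ ∑-cong (λ k → cong (a k *_) (trans (x≡flow k) (netFlow w k))) ⟩
      ∑ (λ k → a k * (∑ (w k) - ∑ (λ i → w i k)))
        ≡⟨ ∑-cong (λ k → *-distribˡ-- (a k) (∑ (w k)) (∑ (λ i → w i k))) ⟩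
      ∑ (λ k → a k * ∑ (w k) - a k * ∑ (λ i → w i k))
        ≡⟨ ∑-distrib-- (λ k → a k * ∑ (w k)) (λ k → a k * ∑ (λ i → w i k)) ⟩
      ∑ (λ k → a k * ∑ (w k)) - ∑ (λ k → a k * ∑ (λ i → w i k))
        ≡⟨ cong₂ _-_ (∑-cong (λ k → *-distribˡ-∑ (a k) (w k)))
                     (trans (∑-cong (λ k → *-distribˡ-∑ (a k) (λ i → w i k))) (∑-comm (λ k i → a k * w i k))) ⟩
      ∑ (λ i → ∑ (λ j → a i * w i j)) - ∑ (λ i → ∑ (λ j → a j * w i j))
        ≡⟨ ∑-distrib-- (λ i → ∑ (λ j → a i * w i j)) (λ i → ∑ (λ j → a j * w i j)) ⟨
      ∑ (λ i → ∑ (λ j → a i * w i j) - ∑ (λ j → a j * w i j))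
        ≡⟨ ∑-cong (λ i → trans (sym (∑-distrib-- (λ j → a i * w i j) (λ j → a j * w i j)))
                               (∑-cong (λ j → factor (a i) (a j) (w i j)))) ⟩
      ∑ (λ i → ∑ (λ j → w i j * (a i - a j))) ∎
      where
      open ≡-Reasoning
      factor : ∀ p q r → p * r - q * r ≡ r * (p - q)
      factor = solve-∀ ℚ-ring

    private
      ∑∑-const : (w : Weights) → ∑ (λ i → ∑ (λ j → w i j)) ≡ 1ℚ → ∀ D →
                 ∑ (λ i → ∑ (λ j → w i j * D)) ≡ D
      ∑∑-const w ∑∑w≡1 D = begin
        ∑ (λ i → ∑ (λ j → w i j * D))  ≡⟨ ∑-cong (λ i → *-distribʳ-∑ D (w i)) ⟨
        ∑ (λ i → ∑ (w i) * D)          ≡⟨ *-distribʳ-∑ D (λ i → ∑ (w i)) ⟨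
        ∑ (λ i → ∑ (w i)) * D          ≡⟨ cong (_* D) ∑∑w≡1 ⟩
        1ℚ * D                         ≡⟨ ℚ.*-identityˡ D ⟩
        D                              ∎
        where open ≡-Reasoning

    module _ {a : Point n} {D : ℚ} where

      SupportedOnGap : Weights → Set
      SupportedOnGap w = ∀ i j → w i j ≡ 0ℚ ⊎ a i - a j ≡ D

      SEP-≤ : (∀ i j → a i - a j ≤ D) → ∀ {x} → SEP n x → a · x ≤ D
      SEP-≤ gap≤D {x} s = begin
        a · x                                ≡⟨ ·-flow a x (weights s) (represents s) ⟩
        ∑ (λ i → ∑ (λ j → w i j * (a i - a j)))
          ≤⟨ ∑-mono-≤ (λ i → ∑-mono-≤ (λ j → *-monoˡ-≤-nonNeg′ (weights-nonNeg s i j) (gap≤D i j))) ⟩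
        ∑ (λ i → ∑ (λ j → w i j * D))        ≡⟨ ∑∑-const w (weights-sum s) D ⟩
        D                                    ∎
        where
        open ℚ.≤-Reasoning
        w = weights s

      SEP-≡⇒supported : (∀ i j → a i - a j ≤ D) → ∀ {x} (s : SEP n x) → a · x ≡ D → SupportedOnGap (weights s)
      SEP-≡⇒supported gap≤D {x} s a·x≡D i j with weights s i j ℚ.≟ 0ℚ
      ... | yes wij≡0 = inj₁ wij≡0
      ... | no  wij≢0 = inj₂ (*-cancelˡ-≢0 (a i - a j) D wij≢0 (termwise i j))
        where
        w = weights s
        termwise≤ : ∀ i j → w i j * (a i - a j) ≤ w i j * D
        termwise≤ i j = *-monoˡ-≤-nonNeg′ (weights-nonNeg s i j) (gap≤D i j)
        ∑∑≡ : ∑ (λ i → ∑ (λ j → w i j * (a i - a j))) ≡ ∑ (λ i → ∑ (λ j → w i j * D))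
        ∑∑≡ = trans (sym (·-flow a x w (represents s))) (trans a·x≡D (sym (∑∑-const w (weights-sum s) D)))
        termwise : ∀ i j → w i j * (a i - a j) ≡ w i j * D
        termwise i = ∑-mono-≤-≡ (termwise≤ i) (∑-mono-≤-≡ (λ i → ∑-mono-≤ (termwise≤ i)) ∑∑≡ i)

      supported⇒SEP-≡ : ∀ {x} (s : SEP n x) → SupportedOnGap (weights s) → a · x ≡ D
      supported⇒SEP-≡ {x} s supported =
        trans (·-flow a x w (represents s))
              (trans (∑-cong (λ i → ∑-cong (λ j → termwise (supported i j)))) (∑∑-const w (weights-sum s) D))
        where
        w = weights s
        termwise : ∀ {i j} → w i j ≡ 0ℚ ⊎ a i - a j ≡ D → w i j * (a i - a j) ≡ w i j * D
        termwise {i} {j} (inj₁ wij≡0) = trans (cong (_* (a i - a j)) wij≡0)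
                                       (trans (ℚ.*-zeroˡ (a i - a j)) (sym (trans (cong (_* D) wij≡0) (ℚ.*-zeroˡ D))))
        termwise {i} {j} (inj₂ gap≡D) = cong (w i j *_) gap≡D

    SEP-sum≡0 : ∀ {x} → SEP n x → ∑ x ≡ 0ℚ
    SEP-sum≡0 {x} s = trans (∑-cong (λ k → sym (ℚ.*-identityˡ (x k))))
                            (supported⇒SEP-≡ {a = λ _ → 1ℚ} s (λ _ _ → inj₂ (ℚ.+-inverseʳ 1ℚ)))

    Represents-isolated : ∀ {x w} → Represents x w → ∀ k →
                          (∀ j → w k j ≡ 0ℚ) → (∀ i → w i k ≡ 0ℚ) → x k ≡ 0ℚ
    Represents-isolated {x} {w} x≡flow k out≡0 in≡0 = begin
      x k                                ≡⟨ trans (x≡flow k) (netFlow w k) ⟩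
      ∑ (λ j → w k j) - ∑ (λ i → w i k)  ≡⟨ cong₂ _-_ (∑-cong out≡0) (∑-cong in≡0) ⟩
      ∑ {n} (λ _ → 0ℚ) - ∑ {n} (λ _ → 0ℚ) ≡⟨ cong₂ _-_ (∑-zero n) (∑-zero n) ⟩
      0ℚ                                 ∎
      where open ≡-Reasoning

    -- (A i * B j) i j is a flow from A to B; disjoint supports keep it off the diagonal.
    SEP-difference : (A B : Point n) → (∀ i → 0ℚ ≤ A i) → (∀ i → 0ℚ ≤ B i) →
                     ∑ A ≡ 1ℚ → ∑ B ≡ 1ℚ → (∀ i → A i * B i ≡ 0ℚ) → SEP n (λ k → A k - B k)
    SEP-difference A B A≥0 B≥0 ∑A≡1 ∑B≡1 AB≡0 =
      (λ i j → A i * B j) , (λ i j → *-nonNeg (A≥0 i) (B≥0 j)) , AB≡0 , ∑∑AB≡1 , A-B≡flow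
      where
      open ≡-Reasoning
      ∑-A*B : ∀ a → ∑ (λ j → a * B j) ≡ a
      ∑-A*B a = trans (sym (*-distribˡ-∑ a B)) (trans (cong (a *_) ∑B≡1) (ℚ.*-identityʳ a))
      ∑-A*b : ∀ b → ∑ (λ i → A i * b) ≡ b
      ∑-A*b b = trans (sym (*-distribʳ-∑ b A)) (trans (cong (_* b) ∑A≡1) (ℚ.*-identityˡ b))
      ∑∑AB≡1 : ∑ (λ i → ∑ (λ j → A i * B j)) ≡ 1ℚ
      ∑∑AB≡1 = trans (∑-cong (λ i → trans (∑-A*B (A i)) (sym (ℚ.*-identityʳ (A i))))) (∑-A*b 1ℚ)
      A-B≡flow : ∀ k → A k - B k ≡ ∑ (λ i → ∑ (λ j → A i * B j * (𝐞 i k - 𝐞 j k)))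
      A-B≡flow k = sym (trans (netFlow (λ i j → A i * B j) k) (cong₂ _-_ (∑-A*B (A k)) (∑-A*b (B k))))

    AffIndPoints : PSet n → ℕ → Set
    AffIndPoints A k = Σ (Fin k → Point n) λ p → (∀ i → A (p i)) × AffInd p

    -- Each λ u with u ≢ j₀ is read off at the coordinate κ u; then ∑ λ ≡ 0 forces λ j₀ ≡ 0.
    AffInd-diagonal : ∀ {K} (p : Fin K → Point n) (j₀ : Fin K) (κ : Fin K → Fin n) →
                      (∀ u → u ≢ j₀ → p u (κ u) ≢ 0ℚ) →
                      (∀ u v → u ≢ j₀ → v ≢ u → p v (κ u) ≡ 0ℚ) → AffInd p
    AffInd-diagonal p j₀ κ diag≢0 offDiag≡0 λ′ ∑λ′≡0 ∑λ′p≡0 = λ′≡0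
      where
      λ′≡0-off : ∀ u → u ≢ j₀ → λ′ u ≡ 0ℚ
      λ′≡0-off u u≢j₀ = x*y≡0⇒x≡0 (diag≢0 u u≢j₀) (begin
        λ′ u * p u (κ u)                 ≡⟨ ∑-single (λ v → λ′ v * p v (κ u)) u (λ v v≢u →
                                              trans (cong (λ′ v *_) (offDiag≡0 u v u≢j₀ v≢u)) (ℚ.*-zeroʳ (λ′ v))) ⟨
        ∑ (λ v → λ′ v * p v (κ u))       ≡⟨ ∑λ′p≡0 (κ u) ⟩
        0ℚ                               ∎)
        where open ≡-Reasoning
      λ′≡0 : ∀ u → λ′ u ≡ 0ℚ
      λ′≡0 u with u Fin.≟ j₀
      ... | no u≢j₀ = λ′≡0-off u u≢j₀
      ... | yes refl = trans (sym (∑-single λ′ j₀ λ′≡0-off)) ∑λ′≡0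

    ·-combination : ∀ {K} (g : Point n) (μ : Fin K → ℚ) (p : Fin K → Point n) →
                    g · (λ c → ∑ (λ i → μ i * p i c)) ≡ ∑ (λ i → μ i * (g · p i))
    ·-combination g μ p = begin
      ∑ (λ c → g c * ∑ (λ i → μ i * p i c))   ≡⟨ ∑-cong (λ c → *-distribˡ-∑ (g c) (λ i → μ i * p i c)) ⟩
      ∑ (λ c → ∑ (λ i → g c * (μ i * p i c))) ≡⟨ ∑-comm (λ c i → g c * (μ i * p i c)) ⟩
      ∑ (λ i → ∑ (λ c → g c * (μ i * p i c))) ≡⟨ ∑-cong (λ i → ∑-cong (λ c → swap (g c) (μ i) (p i c))) ⟩
      ∑ (λ i → ∑ (λ c → μ i * (g c * p i c))) ≡⟨ ∑-cong (λ i → *-distribˡ-∑ (μ i) (λ c → g c * p i c)) ⟨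
      ∑ (λ i → μ i * (g · p i))               ∎
      where
      open ≡-Reasoning
      swap : ∀ x y z → x * (y * z) ≡ y * (x * z)
      swap = solve-∀ ℚ-ring

    AffInd-∷ : ∀ {K} {p : Fin K → Point n} → AffInd p → ∀ {q} (g : Point n) {β} →
               (∀ i → g · p i ≡ β) → g · q ≢ β → AffInd (q ∷ p)
    AffInd-∷ {p = p} p-ind {q} g {β} g·p≡β g·q≢β λ′ ∑λ′≡0 ∑λ′p≡0 = λ′≡0
      where
      open ≡-Reasoning
      λ₀ = λ′ zero
      λs = λ′ ∘ suc
      ∑λs≡-λ₀ : ∑ λs ≡ - λ₀
      ∑λs≡-λ₀ = inverseʳ-unique λ₀ (∑ λs) ∑λ′≡0
      λ₀*gap≡0 : λ₀ * (g · q - β) ≡ 0ℚ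
      λ₀*gap≡0 = begin
        λ₀ * (g · q - β)                               ≡⟨ expand λ₀ (g · q) β ⟩
        λ₀ * (g · q) + - λ₀ * β                        ≡⟨ cong (λ z → λ₀ * (g · q) + z * β) ∑λs≡-λ₀ ⟨
        λ₀ * (g · q) + ∑ λs * β                        ≡⟨ cong (λ₀ * (g · q) +_) (*-distribʳ-∑ β λs) ⟩
        λ₀ * (g · q) + ∑ (λ i → λs i * β)
          ≡⟨ cong (λ₀ * (g · q) +_) (∑-cong (λ i → cong (λs i *_) (g·p≡β i))) ⟨
        ∑ (λ i → λ′ i * (g · (q ∷ p) i))               ≡⟨ ·-combination g λ′ (q ∷ p) ⟨
        g · (λ c → ∑ (λ i → λ′ i * (q ∷ p) i c))
          ≡⟨ ∑-cong (λ c → trans (cong (g c *_) (∑λ′p≡0 c)) (ℚ.*-zeroʳ (g c))) ⟩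
        ∑ {n} (λ _ → 0ℚ)                               ≡⟨ ∑-zero n ⟩
        0ℚ                                             ∎
        where
        expand : ∀ l x b → l * (x - b) ≡ l * x + - l * b
        expand = solve-∀ ℚ-ring
      λ₀≡0 : λ₀ ≡ 0ℚ
      λ₀≡0 = x*y≡0⇒x≡0 (g·q≢β ∘ x∙y⁻¹≈ε⇒x≈y (g · q) β) λ₀*gap≡0
      λs≡0 : ∀ i → λs i ≡ 0ℚ
      λs≡0 = p-ind λs (trans ∑λs≡-λ₀ (cong -_ λ₀≡0)) λ c → begin
        ∑ (λ i → λs i * p i c)                 ≡⟨ 0*x+y≡y (q c) _ ⟨
        0ℚ * q c + ∑ (λ i → λs i * p i c)      ≡⟨ cong (λ z → z * q c + ∑ (λ i → λs i * p i c)) λ₀≡0 ⟨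
        λ₀ * q c + ∑ (λ i → λs i * p i c)      ≡⟨ ∑λ′p≡0 c ⟩
        0ℚ                                     ∎
      λ′≡0 : ∀ i → λ′ i ≡ 0ℚ
      λ′≡0 zero    = λ₀≡0
      λ′≡0 (suc i) = λs≡0 i

    AffInd-tail : ∀ {K} (p : Fin (suc K) → Point n) → AffInd p → AffInd (p ∘ suc)
    AffInd-tail p p-ind λ′ ∑λ′≡0 ∑λ′p≡0 i =
      p-ind (0ℚ ∷ λ′) (trans (ℚ.+-identityˡ (∑ λ′)) ∑λ′≡0)
            (λ c → trans (0*x+y≡y (p zero c) _) (∑λ′p≡0 c)) (suc i)

    AffIndPoints-shrink : ∀ {A k K} → k ≤′ K → AffIndPoints A K → AffIndPoints A k
    AffIndPoints-shrink ≤′-refl        ps              = ps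
    AffIndPoints-shrink {A} (≤′-step k≤′K) (p , p∈A , p-ind) =
      AffIndPoints-shrink {A} k≤′K (p ∘ suc , p∈A ∘ suc , AffInd-tail p p-ind)

    AffIndPoints-≤-dim : ∀ {A k K} → AffDimPlus1 A k → AffIndPoints A K → K ℕ.≤ k
    AffIndPoints-≤-dim {A} {k} {K} dim ps with K ℕ.≤? k
    ... | yes K≤k = K≤k
    ... | no  K≰k with AffIndPoints-shrink {A} (ℕ.≤⇒≤′ (ℕ.≰⇒> K≰k)) ps
    ...   | p , p∈A , p-ind = ⊥-elim (proj₂ dim p p∈A p-ind)

  ≐-trans : ∀ {n} {A B C : PSet n} → A ≐ B → B ≐ C → A ≐ C
  ≐-trans (A⊆B , B⊆A) (B⊆C , C⊆B) = (λ x → B⊆C x ∘ A⊆B x) , (λ x → B⊆A x ∘ C⊆B x)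

  ≐-sym : ∀ {n} {A B : PSet n} → A ≐ B → B ≐ A
  ≐-sym (A⊆B , B⊆A) = B⊆A , A⊆B

  module Fibres {n m : ℕ} (c : Fin n → Fin m) (r : Fin m → Fin n) (c∘r : ∀ t → c (r t) ≡ t) where

    fibreSum : Fin m → (Fin n → ℚ) → ℚ
    fibreSum t g = ∑ (λ j → 𝐞 (c j) t * g j)

    size : Fin m → ℚ
    size t = ∑ (λ j → 𝐞 (c j) t)

    size-pos : ∀ t → 0ℚ < size t
    size-pos t = ℚ.<-≤-trans (ℚ.positive⁻¹ 1ℚ)
      (subst (_≤ size t) (trans (cong (λ u → 𝐞 u t) (c∘r t)) (𝐞-diag t)) (term≤∑ (λ j → 𝐞-nonNeg (c j) t) (r t)))

    instance
      size-nonZero : ∀ {t} → NonZero (size t)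
      size-nonZero {t} = ℚ.>-nonZero (size-pos t)

    size≢0 : ∀ t → size t ≢ 0ℚ
    size≢0 t size≡0 = ℚ.<-irrefl (sym size≡0) (size-pos t)

    1/size-pos : ∀ t → 0ℚ < 1/ size t
    1/size-pos t = ℚ.positive⁻¹ _ {{ℚ.1/pos⇒pos (size t) {{ℚ.positive (size-pos t)}}}}

    1/size≢0 : ∀ t → 1/ size t ≢ 0ℚ
    1/size≢0 t 1/size≡0 = ℚ.<-irrefl (sym 1/size≡0) (1/size-pos t)

    ∑-by-fibres : ∀ g → ∑ g ≡ ∑ (λ t → fibreSum t g)
    ∑-by-fibres g = trans (∑-cong (λ j → sym (·-𝐞 (c j) (λ _ → g j)))) (∑-comm (λ j t → 𝐞 (c j) t * g j))

    fibreSum-∘c : ∀ t g h → fibreSum t (λ j → g j * h (c j)) ≡ fibreSum t g * h t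
    fibreSum-∘c t g h = begin
      ∑ (λ j → 𝐞 (c j) t * (g j * h (c j)))  ≡⟨ ∑-cong (λ j → assoc (𝐞 (c j) t) (g j) (h (c j))) ⟩
      ∑ (λ j → 𝐞 (c j) t * h (c j) * g j)    ≡⟨ ∑-cong (λ j → cong (_* g j) (𝐞-subst (c j) t h)) ⟩
      ∑ (λ j → 𝐞 (c j) t * h t * g j)        ≡⟨ ∑-cong (λ j → assoc′ (𝐞 (c j) t) (h t) (g j)) ⟩
      ∑ (λ j → 𝐞 (c j) t * g j * h t)        ≡⟨ *-distribʳ-∑ (h t) (λ j → 𝐞 (c j) t * g j) ⟨
      fibreSum t g * h t                     ∎
      where
      open ≡-Reasoning
      assoc : ∀ e x y → e * (x * y) ≡ e * y * x
      assoc = solve-∀ ℚ-ring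
      assoc′ : ∀ e y x → e * y * x ≡ e * x * y
      assoc′ = solve-∀ ℚ-ring

    fibreSum-const : ∀ t h → fibreSum t (h ∘ c) ≡ size t * h t
    fibreSum-const t h = trans (∑-cong (λ j → 𝐞-subst (c j) t h)) (sym (*-distribʳ-∑ (h t) (λ j → 𝐞 (c j) t)))

    ∑-regroup : ∀ g h → ∑ (λ j → g j * h (c j)) ≡ ∑ (λ t → fibreSum t g * h t)
    ∑-regroup g h = trans (∑-by-fibres (λ j → g j * h (c j))) (∑-cong (λ t → fibreSum-∘c t g h))

    average : (Fin n → ℚ) → Fin m → ℚ
    average g t = fibreSum t g * 1/ size t

    size*average : ∀ g t → size t * average g t ≡ fibreSum t g
    size*average g t = begin
      size t * (fibreSum t g * 1/ size t)  ≡⟨ ℚ.*-comm (size t) _ ⟩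
      fibreSum t g * 1/ size t * size t    ≡⟨ ℚ.*-assoc (fibreSum t g) _ _ ⟩
      fibreSum t g * (1/ size t * size t)  ≡⟨ cong (fibreSum t g *_) (ℚ.*-inverseˡ (size t)) ⟩
      fibreSum t g * 1ℚ                    ≡⟨ ℚ.*-identityʳ (fibreSum t g) ⟩
      fibreSum t g                         ∎
      where open ≡-Reasoning

    average-∘c : ∀ h t → average (h ∘ c) t ≡ h t
    average-∘c h t = *-cancelˡ-≢0 (average (h ∘ c) t) (h t) (size≢0 t)
                                  (trans (size*average (h ∘ c) t) (fibreSum-const t h))

    fibreSum-average : ∀ g t → fibreSum t (average g ∘ c) ≡ fibreSum t g
    fibreSum-average g t = trans (fibreSum-const t (average g)) (size*average g t)

    ·-fibreConstant : ∀ {x} (X : Fin m → ℚ) → (∀ j → x j ≡ X (c j)) →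
                      ∀ a b → (∀ t → fibreSum t a ≡ fibreSum t b) → a · x ≡ b · x
    ·-fibreConstant {x} X x≡X∘c a b fibreSum≡ = begin
      ∑ (λ j → a j * x j)              ≡⟨ ∑-cong (λ j → cong (a j *_) (x≡X∘c j)) ⟩
      ∑ (λ j → a j * X (c j))          ≡⟨ ∑-regroup a X ⟩
      ∑ (λ t → fibreSum t a * X t)     ≡⟨ ∑-cong (λ t → cong (_* X t) (fibreSum≡ t)) ⟩
      ∑ (λ t → fibreSum t b * X t)     ≡⟨ ∑-regroup b X ⟨
      ∑ (λ j → b j * X (c j))          ≡⟨ ∑-cong (λ j → cong (b j *_) (x≡X∘c j)) ⟨
      ∑ (λ j → b j * x j)              ∎
      where open ≡-Reasoning

    fibreConstant≡0 : ∀ (Y : Fin m → ℚ) t₀ → ∑ (Y ∘ c) ≡ 0ℚ → (∀ t → t ≢ t₀ → Y t ≡ 0ℚ) →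
                      ∀ t → Y t ≡ 0ℚ
    fibreConstant≡0 Y t₀ ∑Y∘c≡0 Y≡0 t with t Fin.≟ t₀
    ... | no t≢t₀ = Y≡0 t t≢t₀
    ... | yes refl = x*y≡0⇒y≡0 (size≢0 t₀) (begin
      size t₀ * Y t₀
        ≡⟨ ∑-single (λ t → size t * Y t) t₀ (λ t t≢t₀ → trans (cong (size t *_) (Y≡0 t t≢t₀)) (ℚ.*-zeroʳ (size t))) ⟨
      ∑ (λ t → size t * Y t)          ≡⟨ ∑-cong (λ t → fibreSum-const t Y) ⟨
      ∑ (λ t → fibreSum t (Y ∘ c))    ≡⟨ ∑-by-fibres (Y ∘ c) ⟨
      ∑ (Y ∘ c)                       ≡⟨ ∑Y∘c≡0 ⟩
      0ℚ                              ∎)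
      where open ≡-Reasoning

    barycentre : Fin m → Point n
    barycentre t k = 𝐞 (c k) t * 1/ size t

    ·-barycentre : ∀ g t → g · barycentre t ≡ average g t
    ·-barycentre g t = begin
      ∑ (λ k → g k * (𝐞 (c k) t * 1/ size t))  ≡⟨ ∑-cong (λ k → rearrange (g k) (𝐞 (c k) t) (1/ size t)) ⟩
      ∑ (λ k → 𝐞 (c k) t * g k * 1/ size t)    ≡⟨ *-distribʳ-∑ (1/ size t) (λ k → 𝐞 (c k) t * g k) ⟨
      average g t                              ∎
      where
      open ≡-Reasoning
      rearrange : ∀ x e i → x * (e * i) ≡ e * x * i
      rearrange = solve-∀ ℚ-ring

    barycentre-nonNeg : ∀ t k → 0ℚ ≤ barycentre t k
    barycentre-nonNeg t k = *-nonNeg (𝐞-nonNeg (c k) t) (ℚ.<⇒≤ (1/size-pos t))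

    barycentre-sum : ∀ t → ∑ (barycentre t) ≡ 1ℚ
    barycentre-sum t = trans (∑-cong (λ k → sym (ℚ.*-identityˡ (barycentre t k))))
                         (trans (·-barycentre (λ _ → 1ℚ) t) (average-∘c (λ _ → 1ℚ) t))

    barycentre-disjoint : ∀ {s t} → s ≢ t → ∀ k → barycentre s k * barycentre t k ≡ 0ℚ
    barycentre-disjoint {s} {t} s≢t k = begin
      𝐞 (c k) s * 1/ size s * (𝐞 (c k) t * 1/ size t)    ≡⟨ regroup (𝐞 (c k) s) (1/ size s) (𝐞 (c k) t) (1/ size t) ⟩
      𝐞 (c k) s * 𝐞 (c k) t * (1/ size s * 1/ size t)   ≡⟨ cong (_* (1/ size s * 1/ size t)) (𝐞-disjoint s≢t (c k)) ⟩
      0ℚ * (1/ size s * 1/ size t)                       ≡⟨ ℚ.*-zeroˡ (1/ size s * 1/ size t) ⟩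
      0ℚ                                                 ∎
      where
      open ≡-Reasoning
      regroup : ∀ a x b y → a * x * (b * y) ≡ a * b * (x * y)
      regroup = solve-∀ ℚ-ring

    arcProfile : Fin m → Fin m → Fin m → ℚ
    arcProfile s t u = 𝐞 u s * 1/ size s - 𝐞 u t * 1/ size t

    arc : Fin m → Fin m → Point n
    arc s t = arcProfile s t ∘ c

    arc-SEP : ∀ {s t} → s ≢ t → SEP n (arc s t)
    arc-SEP {s} {t} s≢t = SEP-difference (barycentre s) (barycentre t) (barycentre-nonNeg s) (barycentre-nonNeg t)
                                          (barycentre-sum s) (barycentre-sum t) (barycentre-disjoint s≢t)

    ·-arc : ∀ h s t → (h ∘ c) · arc s t ≡ h s - h t
    ·-arc h s t = begin
      ∑ (λ k → h (c k) * (barycentre s k - barycentre t k))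
        ≡⟨ ∑-cong (λ k → *-distribˡ-- (h (c k)) (barycentre s k) (barycentre t k)) ⟩
      ∑ (λ k → h (c k) * barycentre s k - h (c k) * barycentre t k)
        ≡⟨ ∑-distrib-- (λ k → h (c k) * barycentre s k) (λ k → h (c k) * barycentre t k) ⟩
      (h ∘ c) · barycentre s - (h ∘ c) · barycentre t
        ≡⟨ cong₂ _-_ (trans (·-barycentre (h ∘ c) s) (average-∘c h s)) (trans (·-barycentre (h ∘ c) t) (average-∘c h t)) ⟩
      h s - h t ∎
      where open ≡-Reasoning

    arc-at : ∀ s t u → arc s t (r u) ≡ arcProfile s t u
    arc-at s t u = cong (arcProfile s t) (c∘r u)

    arc-off : ∀ {s t u} → u ≢ s → u ≢ t → arc s t (r u) ≡ 0ℚ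
    arc-off {s} {t} {u} u≢s u≢t = begin
      arc s t (r u)                           ≡⟨ arc-at s t u ⟩
      𝐞 u s * 1/ size s - 𝐞 u t * 1/ size t
        ≡⟨ cong₂ (λ a b → a * 1/ size s - b * 1/ size t) (𝐞-offDiag u≢s) (𝐞-offDiag u≢t) ⟩
      0ℚ * 1/ size s - 0ℚ * 1/ size t         ≡⟨ cong₂ _-_ (ℚ.*-zeroˡ (1/ size s)) (ℚ.*-zeroˡ (1/ size t)) ⟩
      0ℚ                                       ∎
      where open ≡-Reasoning

    arc-source : ∀ {u t} → u ≢ t → arc u t (r u) ≢ 0ℚ
    arc-source {u} {t} u≢t arc≡0 = 1/size≢0 u (begin
      1/ size u                                ≡⟨ simplify (1/ size u) (1/ size t) ⟨
      1ℚ * 1/ size u - 0ℚ * 1/ size t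
        ≡⟨ cong₂ (λ a b → a * 1/ size u - b * 1/ size t) (𝐞-diag u) (𝐞-offDiag u≢t) ⟨
      arcProfile u t u                        ≡⟨ arc-at u t u ⟨
      arc u t (r u)                           ≡⟨ arc≡0 ⟩
      0ℚ                                       ∎)
      where
      open ≡-Reasoning
      simplify : ∀ x y → 1ℚ * x - 0ℚ * y ≡ x
      simplify = solve-∀ ℚ-ring

    arc-target : ∀ {s u} → u ≢ s → arc s u (r u) ≢ 0ℚ
    arc-target {s} {u} u≢s arc≡0 = 1/size≢0 u (begin
      1/ size u                                  ≡⟨ simplify (1/ size s) (1/ size u) ⟨
      - (0ℚ * 1/ size s - 1ℚ * 1/ size u)
        ≡⟨ cong -_ (cong₂ (λ a b → a * 1/ size s - b * 1/ size u) (𝐞-offDiag u≢s) (𝐞-diag u)) ⟨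
      - arcProfile s u u                        ≡⟨ cong -_ (arc-at s u u) ⟨
      - arc s u (r u)                           ≡⟨ cong -_ arc≡0 ⟩
      0ℚ                                         ∎)
      where
      open ≡-Reasoning
      simplify : ∀ x y → - (0ℚ * x - 1ℚ * y) ≡ y
      simplify = solve-∀ ℚ-ring

  module FixedPolytope {n m′ : ℕ} (σ : Permutation′ n) (c : Fin n → Fin (suc m′)) (cd : IsCycleDecomp σ c) where

    m : ℕ
    m = suc m′

    r : Fin m → Fin n
    r t = proj₁ (proj₁ cd t)

    c∘r : ∀ t → c (r t) ≡ t
    c∘r t = proj₂ (proj₁ cd t)

    open Fibres c r c∘r public

    P : PSet n
    P = Fixed σ (SEP n)

    Invariant : Point n → Set
    Invariant x = ∀ j → act σ x j ≡ x j

    module _ {x : Point n} (x-inv : Invariant x) where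

      invariant-σ : ∀ i → x (σ ⟨$⟩ʳ i) ≡ x i
      invariant-σ i = trans (sym (x-inv (σ ⟨$⟩ʳ i))) (cong x (inverseˡ σ))

      invariant-σ^ : ∀ k i → x (σ^ σ k i) ≡ x i
      invariant-σ^ zero    i = refl
      invariant-σ^ (suc k) i = trans (invariant-σ (σ^ σ k i)) (invariant-σ^ k i)

      invariant⇒fibreConstant : ∀ j → x j ≡ x (r (c j))
      invariant⇒fibreConstant j with proj₁ (proj₂ cd) (r (c j)) j (c∘r (c j))
      ... | k , σ^k[rcj]≡j = trans (cong x (sym σ^k[rcj]≡j)) (invariant-σ^ k (r (c j)))

    fibreConstant⇒invariant : ∀ h → Invariant (h ∘ c)
    fibreConstant⇒invariant h j = cong h (trans (sym (proj₂ (proj₂ cd) (σ ⟨$⟩ˡ j) 1)) (cong c (inverseʳ σ)))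

    arc∈P : ∀ {s t} → s ≢ t → P (arc s t)
    arc∈P {s} {t} s≢t = arc-SEP s≢t , fibreConstant⇒invariant (arcProfile s t)

    -- Points of P are constant on cycles and sum to zero, so a linear dependence among the
    -- vectors (1, x (r 1), …, x (r (m - 1))) of m + 1 such points is an affine dependence.
    P-noAffInd : (p : Fin (suc m) → Point n) → (∀ i → P (p i)) → ¬ AffInd p
    P-noAffInd p p∈P p-ind = noDependence (dependence m rows)
      where
      rows : Fin (suc m) → Fin m → ℚ
      rows i = 1ℚ ∷ (λ l → p i (r (suc l)))
      noDependence : ∃ (IsDependence rows) → ⊥
      noDependence (μ , (i₀ , μi₀≢0) , μ-dep) = μi₀≢0 (p-ind μ ∑μ≡0 combination≡0 i₀)
        where
        open ≡-Reasoning
        ∑μ≡0 : ∑ μ ≡ 0ℚ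
        ∑μ≡0 = trans (∑-cong (λ i → sym (ℚ.*-identityʳ (μ i)))) (μ-dep zero)
        Y : Fin m → ℚ
        Y t = ∑ (λ i → μ i * p i (r t))
        combination≡Y∘c : ∀ k → ∑ (λ i → μ i * p i k) ≡ Y (c k)
        combination≡Y∘c k = ∑-cong (λ i → cong (μ i *_) (invariant⇒fibreConstant (proj₂ (p∈P i)) k))
        ∑Y∘c≡0 : ∑ (Y ∘ c) ≡ 0ℚ
        ∑Y∘c≡0 = begin
          ∑ (Y ∘ c)                               ≡⟨ ∑-cong combination≡Y∘c ⟨
          ∑ (λ k → ∑ (λ i → μ i * p i k))         ≡⟨ ∑-comm (λ k i → μ i * p i k) ⟩
          ∑ (λ i → ∑ (λ k → μ i * p i k))         ≡⟨ ∑-cong (λ i → *-distribˡ-∑ (μ i) (p i)) ⟨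
          ∑ (λ i → μ i * ∑ (p i))
            ≡⟨ ∑-cong (λ i → trans (cong (μ i *_) (SEP-sum≡0 (proj₁ (p∈P i)))) (ℚ.*-zeroʳ (μ i))) ⟩
          ∑ {suc m} (λ _ → 0ℚ)                    ≡⟨ ∑-zero (suc m) ⟩
          0ℚ                                      ∎
        Y≡0 : ∀ t → Y t ≡ 0ℚ
        Y≡0 = fibreConstant≡0 Y zero ∑Y∘c≡0 λ where
          zero    0≢0 → ⊥-elim (0≢0 refl)
          (suc l) _   → μ-dep (suc l)
        combination≡0 : ∀ k → ∑ (λ i → μ i * p i k) ≡ 0ℚ
        combination≡0 k = trans (combination≡Y∘c k) (Y≡0 (c k))

    cycleUnion : Subset m → Subset n
    cycleUnion T = tabulate (λ j → lookup T (c j))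

    module _ (T : Subset m) where

      𝐞[cycleUnion] : ∀ k → 𝐞[ cycleUnion T ] k ≡ 𝐞[ T ] (c k)
      𝐞[cycleUnion] k = cong indicator (lookup∘tabulate (λ j → lookup T (c j)) k)

      ∈-cycleUnion⁺ : ∀ {j} → c j ∈ T → j ∈ cycleUnion T
      ∈-cycleUnion⁺ {j} cj∈T =
        lookup⇒[]= j (cycleUnion T) (trans (lookup∘tabulate (λ j → lookup T (c j)) j) ([]=⇒lookup cj∈T))

      ∈-cycleUnion⁻ : ∀ {j} → j ∈ cycleUnion T → c j ∈ T
      ∈-cycleUnion⁻ {j} j∈ = lookup⇒[]= (c j) T (trans (sym (lookup∘tabulate (λ j → lookup T (c j)) j)) ([]=⇒lookup j∈))

      cycleUnion-isCycleUnion : CycleUnion c (cycleUnion T)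
      cycleUnion-isCycleUnion t with t ∈? T
      ... | yes t∈T = inj₂ λ { j refl → ∈-cycleUnion⁺ t∈T }
      ... | no  t∉T = inj₁ λ { j refl j∈ → t∉T (∈-cycleUnion⁻ j∈) }

      cycleFacet : PSet n
      cycleFacet x = P x × (𝐞[ cycleUnion T ] · x ≡ 1ℚ)

      ·-arc-cycleUnion : ∀ s t → 𝐞[ cycleUnion T ] · arc s t ≡ 𝐞[ T ] s - 𝐞[ T ] t
      ·-arc-cycleUnion s t = trans (∑-cong (λ k → cong (_* arc s t k) (𝐞[cycleUnion] k))) (·-arc 𝐞[ T ] s t)

      cycleUnion-valid : ∀ x → P x → 𝐞[ cycleUnion T ] · x ≤ 1ℚ
      cycleUnion-valid x x∈P = SEP-≤ {a = 𝐞[ cycleUnion T ]} (𝐞[]-gap≤1 (cycleUnion T)) (proj₁ x∈P)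

      arc∈cycleFacet : ∀ {s t} → s ∈ T → t ∉ T → cycleFacet (arc s t)
      arc∈cycleFacet {s} {t} s∈T t∉T =
        arc∈P (λ { refl → t∉T s∈T }) , trans (·-arc-cycleUnion s t) (∈∉⇒𝐞[]-gap≡1 T s∈T t∉T)

      arc∉cycleFacet : ∀ {s t} → s ∉ T → ¬ cycleFacet (arc s t)
      arc∉cycleFacet {s} {t} s∉T (_ , gap≡1) = s∉T (proj₁ (𝐞[]-gap≡1⇒∈∉ T (trans (sym (·-arc-cycleUnion s t)) gap≡1)))

    cycleFacet-⊆⇒⊆ : ∀ {T T′} → (∃ λ s → s ∉ T) → cycleFacet T ⊆ₚ cycleFacet T′ → T ⊆ T′
    cycleFacet-⊆⇒⊆ {T} {T′} (s , s∉T) F⊆F′ {t} t∈T with t ∈? T′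
    ... | yes t∈T′ = t∈T′
    ... | no  t∉T′ = ⊥-elim (arc∉cycleFacet T′ t∉T′ (F⊆F′ (arc t s) (arc∈cycleFacet T t∈T s∉T)))

    cycleFacet-injective : ∀ {T T′} → NonemptyProper T → NonemptyProper T′ → cycleFacet T ≐ cycleFacet T′ → T ≡ T′
    cycleFacet-injective (_ , ∉T) (_ , ∉T′) (F⊆F′ , F′⊆F) =
      ⊆-antisym (cycleFacet-⊆⇒⊆ ∉T F⊆F′) (cycleFacet-⊆⇒⊆ ∉T′ F′⊆F)

    module CycleFacet (T : Subset m) {tin tout : Fin m} (tin∈T : tin ∈ T) (tout∉T : tout ∉ T) where

      tout≢tin : tout ≢ tin
      tout≢tin refl = tout∉T tin∈T

      facetPoint : Fin m → Point n
      facetPoint t with t ∈? T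
      ... | yes _ = arc t tout
      ... | no  _ = arc tin t

      facetPoint∈cycleFacet : ∀ t → cycleFacet T (facetPoint t)
      facetPoint∈cycleFacet t with t ∈? T
      ... | yes t∈T = arc∈cycleFacet T t∈T tout∉T
      ... | no  t∉T = arc∈cycleFacet T tin∈T t∉T

      facetPoint-diag : ∀ {t} → t ≢ tin → t ≢ tout → facetPoint t (r t) ≢ 0ℚ
      facetPoint-diag {t} t≢tin t≢tout with t ∈? T
      ... | yes _ = arc-source t≢tout
      ... | no  _ = arc-target t≢tin

      facetPoint-off : ∀ {t t′} → t ≢ t′ → t ≢ tin → t ≢ tout → facetPoint t′ (r t) ≡ 0ℚ
      facetPoint-off {t} {t′} t≢t′ t≢tin t≢tout with t′ ∈? T
      ... | yes _ = arc-off t≢t′ t≢tout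
      ... | no  _ = arc-off t≢tin t≢t′

      -- Indexed by the cycles t ≢ tout; the point at t = tin is the p j₀ of AffInd-diagonal.
      cycleFacet-points : AffIndPoints (cycleFacet T) m′
      cycleFacet-points = p , facetPoint∈cycleFacet ∘ punchIn tout ,
                          AffInd-diagonal p u₀ (r ∘ punchIn tout) diag off
        where
        p : Fin m′ → Point n
        p = facetPoint ∘ punchIn tout
        u₀ : Fin m′
        u₀ = punchOut tout≢tin
        ≢tin : ∀ {u} → u ≢ u₀ → punchIn tout u ≢ tin
        ≢tin {u} u≢u₀ eq = u≢u₀ (punchIn-injective tout u u₀ (trans eq (sym (punchIn-punchOut tout≢tin))))
        diag : ∀ u → u ≢ u₀ → p u (r (punchIn tout u)) ≢ 0ℚ
        diag u u≢u₀ = facetPoint-diag (≢tin u≢u₀) (punchInᵢ≢i tout u)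
        off : ∀ u v → u ≢ u₀ → v ≢ u → p v (r (punchIn tout u)) ≡ 0ℚ
        off u v u≢u₀ v≢u =
          facetPoint-off (λ eq → v≢u (punchIn-injective tout v u (sym eq))) (≢tin u≢u₀) (punchInᵢ≢i tout u)

      extend : ∀ {k} → AffIndPoints (cycleFacet T) k → AffIndPoints P (suc k)
      extend (q , q∈F , q-ind) =
        arc tout tin ∷ q ,
        (λ { zero → arc∈P tout≢tin ; (suc i) → proj₁ (q∈F i) }) ,
        AffInd-∷ q-ind 𝐞[ cycleUnion T ] (proj₂ ∘ q∈F) (arc∉cycleFacet T tout∉T ∘ (arc∈P tout≢tin ,_))

      P-dim : AffDimPlus1 P m
      P-dim = extend cycleFacet-points , P-noAffInd

      cycleFacet-dim : AffDimPlus1 (cycleFacet T) m′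
      cycleFacet-dim = cycleFacet-points , λ q q∈F q-ind →
        let (p , p∈P , p-ind) = extend (q , q∈F , q-ind) in P-noAffInd p p∈P p-ind

      isFacet : IsFacet P (cycleFacet T)
      isFacet =
        (𝐞[ cycleUnion T ] , 1ℚ , cycleUnion-valid T , (λ _ x∈F → x∈F) , (λ _ x∈F → x∈F)) ,
        (arc tin tout , arc∈cycleFacet T tin∈T tout∉T) ,
        (m′ , P-dim , cycleFacet-dim)

    cycleFacet-isFacet : ∀ {T} → NonemptyProper T → IsFacet P (cycleFacet T)
    cycleFacet-isFacet {T} ((_ , tin∈T) , (_ , tout∉T)) = CycleFacet.isFacet T tin∈T tout∉T

    cycleUnion-nonemptyProper : ∀ {T} → NonemptyProper T → NonemptyProper (cycleUnion T)
    cycleUnion-nonemptyProper {T} ((tin , tin∈T) , (tout , tout∉T)) =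
      (r tin , ∈-cycleUnion⁺ T (subst (_∈ T) (sym (c∘r tin)) tin∈T)) ,
      (r tout , tout∉T ∘ subst (_∈ T) (c∘r tout) ∘ ∈-cycleUnion⁻ T)

    cycleFacet⊆SEPFacet : ∀ T → cycleFacet T ⊆ₚ SEPFacet n (cycleUnion T)
    cycleFacet⊆SEPFacet T x ((x∈SEP , _) , 𝐞·x≡1) = x∈SEP , 𝐞·x≡1

    cycleFacet-cong : ∀ {T T′} → cycleUnion T ≡ cycleUnion T′ → cycleFacet T ≐ cycleFacet T′
    cycleFacet-cong eq = (λ x (x∈P , 𝐞·x≡1) → x∈P , subst (λ S → 𝐞[ S ] · x ≡ 1ℚ) eq 𝐞·x≡1) ,
                         (λ x (x∈P , 𝐞·x≡1) → x∈P , subst (λ S → 𝐞[ S ] · x ≡ 1ℚ) (sym eq) 𝐞·x≡1)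

  maximum-attained : ∀ {k} (f : Fin (suc k) → ℚ) → ∃ λ t → ∀ u → f u ≤ f t
  maximum-attained f = argmax f zero (allFin _) , λ u → All.lookup (f[xs]≤f[argmax] {f = f} zero (allFin _)) (∈-allFin u)

  minimum-attained : ∀ {k} (f : Fin (suc k) → ℚ) → ∃ λ t → ∀ u → f t ≤ f u
  minimum-attained f = argmin f zero (allFin _) , λ u → All.lookup (f[argmin]≤f[xs] {f = f} zero (allFin _)) (∈-allFin u)

  module _ {k} {P : Pred (Fin k) 0ℓ} (P? : Decidable P) where

    select : Subset k
    select = tabulate (does ∘ P?)

    ∈-select⁺ : ∀ {t} → P t → t ∈ select
    ∈-select⁺ {t} pt = lookup⇒[]= t select (trans (lookup∘tabulate (does ∘ P?) t) (dec-true (P? t) pt))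

    ∈-select⁻ : ∀ {t} → t ∈ select → P t
    ∈-select⁻ {t} t∈ = fromDoes (P? t) (trans (sym (lookup∘tabulate (does ∘ P?) t)) ([]=⇒lookup t∈))
      where
      fromDoes : ∀ {A : Set} (a? : Dec A) → does a? ≡ true → A
      fromDoes (yes a) _ = a

  module FacetClassification {n m′ : ℕ} (σ : Permutation′ n) (c : Fin n → Fin (suc m′)) (cd : IsCycleDecomp σ c) where
    open FixedPolytope σ c cd

    module Classify (F : PSet n) (a : Point n) (b : ℚ)
                    (valid : ∀ x → P x → a · x ≤ b)
                    (F⊆ : F ⊆ₚ (λ x → P x × (a · x ≡ b))) (⊆F : (λ x → P x × (a · x ≡ b)) ⊆ₚ F)
                    (x₀ : Point n) (x₀∈F : F x₀) (k : ℕ) (P-dim′ : AffDimPlus1 P (suc k)) (F-dim : AffDimPlus1 F k)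
                    where

      α : Fin m → ℚ
      α = average a

      ā : Point n
      ā = α ∘ c

      a·x≡ā·x : ∀ {x} → P x → a · x ≡ ā · x
      a·x≡ā·x {x} x∈P = ·-fibreConstant (x ∘ r) (invariant⇒fibreConstant (proj₂ x∈P)) a ā
                                        (λ t → sym (fibreSum-average a t))

      x₀∈P : P x₀
      x₀∈P = proj₁ (F⊆ x₀ x₀∈F)

      a·x₀≡b : a · x₀ ≡ b
      a·x₀≡b = proj₂ (F⊆ x₀ x₀∈F)

      tmax tmin : Fin m
      tmax = proj₁ (maximum-attained α)
      tmin = proj₁ (minimum-attained α)

      αmax αmin D : ℚ
      αmax = α tmax
      αmin = α tmin
      D = αmax - αmin

      α≤αmax : ∀ t → α t ≤ αmax
      α≤αmax = proj₂ (maximum-attained α)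

      αmin≤α : ∀ t → αmin ≤ α t
      αmin≤α = proj₂ (minimum-attained α)

      ā-gap≤D : ∀ i j → ā i - ā j ≤ D
      ā-gap≤D i j = ℚ.+-mono-≤ (α≤αmax (c i)) (ℚ.neg-antimono-≤ (αmin≤α (c j)))

      gap≡D⇒extreme : ∀ {s t} → α s - α t ≡ D → α s ≡ αmax × α t ≡ αmin
      gap≡D⇒extreme {s} {t} gap≡D = proj₁ extreme , ℚ.neg-injective (proj₂ extreme)
        where extreme = +-mono-≤-≡ (α≤αmax s) (ℚ.neg-antimono-≤ (αmin≤α t)) gap≡D

      P-bound : ∀ {x} → P x → a · x ≤ D
      P-bound x∈P = subst (_≤ D) (sym (a·x≡ā·x x∈P)) (SEP-≤ {a = ā} ā-gap≤D (proj₁ x∈P))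

      -- If α were constant, the facet would be all of P, which has larger dimension.
      αmax≢αmin : αmax ≢ αmin
      αmax≢αmin αmax≡αmin = ℕ.<-irrefl refl (AffIndPoints-≤-dim {A = F} F-dim (p , P⊆F ∘ p∈P , p-ind))
        where
        α≡αmax : ∀ t → α t ≡ αmax
        α≡αmax t = ℚ.≤-antisym (α≤αmax t) (subst (_≤ α t) (sym αmax≡αmin) (αmin≤α t))
        a·x≡0 : ∀ {x} → P x → a · x ≡ 0ℚ
        a·x≡0 x∈P = trans (a·x≡ā·x x∈P) (supported⇒SEP-≡ {a = ā} (proj₁ x∈P) λ i j →
          inj₂ (trans (cong₂ _-_ (α≡αmax (c i)) (α≡αmax (c j))) (ℚ.+-inverseʳ αmax)))
        P⊆F : ∀ {x} → P x → F x
        P⊆F {x} x∈P = ⊆F x (x∈P , trans (a·x≡0 x∈P) (trans (sym (a·x≡0 x₀∈P)) a·x₀≡b))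
        p = proj₁ (proj₁ P-dim′)
        p∈P = proj₁ (proj₂ (proj₁ P-dim′))
        p-ind = proj₂ (proj₂ (proj₁ P-dim′))

      tmax≢tmin : tmax ≢ tmin
      tmax≢tmin = αmax≢αmin ∘ cong α

      b≡D : b ≡ D
      b≡D = ℚ.≤-antisym (subst (_≤ D) a·x₀≡b (P-bound x₀∈P)) (begin
        D                          ≡⟨ ·-arc α tmax tmin ⟨
        ā · arc tmax tmin         ≡⟨ a·x≡ā·x (arc∈P tmax≢tmin) ⟨
        a · arc tmax tmin         ≤⟨ valid (arc tmax tmin) (arc∈P tmax≢tmin) ⟩
        b                          ∎)
        where open ℚ.≤-Reasoning

      T : Subset m
      T = select (λ t → α t ℚ.≟ αmax)

      ∈T⁻ : ∀ {t} → t ∈ T → α t ≡ αmax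
      ∈T⁻ = ∈-select⁻ (λ t → α t ℚ.≟ αmax)

      tmax∈T : tmax ∈ T
      tmax∈T = ∈-select⁺ (λ t → α t ℚ.≟ αmax) refl

      tmin∉T : tmin ∉ T
      tmin∉T tmin∈T = αmax≢αmin (sym (∈T⁻ tmin∈T))

      F-supported : ∀ {x} → F x → (x∈P : P x) → SupportedOnGap {a = ā} {D = D} (weights (proj₁ x∈P))
      F-supported {x} x∈F x∈P =
        SEP-≡⇒supported {a = ā} {D = D} ā-gap≤D (proj₁ x∈P)
                        (trans (sym (a·x≡ā·x x∈P)) (trans (proj₂ (F⊆ x x∈F)) b≡D))

      F⊆cycleFacet : F ⊆ₚ cycleFacet T
      F⊆cycleFacet x x∈F = x∈P , supported⇒SEP-≡ {a = 𝐞[ cycleUnion T ]} {D = 1ℚ} (proj₁ x∈P) λ i j →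
                                    map₂ cycleGap (F-supported x∈F x∈P i j)
        where
        x∈P = proj₁ (F⊆ x x∈F)
        cycleGap : ∀ {i j} → ā i - ā j ≡ D → 𝐞[ cycleUnion T ] i - 𝐞[ cycleUnion T ] j ≡ 1ℚ
        cycleGap gap≡D = ∈∉⇒𝐞[]-gap≡1 (cycleUnion T)
          (∈-cycleUnion⁺ T (∈-select⁺ (λ t → α t ℚ.≟ αmax) (proj₁ (gap≡D⇒extreme gap≡D))))
          (λ j∈ → αmax≢αmin (trans (sym (∈T⁻ (∈-cycleUnion⁻ T j∈))) (proj₂ (gap≡D⇒extreme gap≡D))))

      -- A cycle t with an intermediate average would make F lie in the hyperplane x (r t) = 0,
      -- which arc tmax t leaves while staying in cycleFacet T: too many independent points there.
      noIntermediate : ∀ t → α t ≢ αmax → α t ≢ αmin → ⊥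
      noIntermediate t ≢max ≢min =
        proj₂ cycleFacet-dim (arc tmax t ∷ q)
          (λ { zero → arc∈cycleFacet T tmax∈T t∉T ; (suc i) → F⊆cycleFacet (q i) (q∈F i) })
          (AffInd-∷ q-ind (𝐞 (r t)) (λ i → trans (·-𝐞 (r t) (q i)) (F-vanishes (q i) (q∈F i)))
                                    (arc-target t≢tmax ∘ trans (sym (·-𝐞 (r t) (arc tmax t)))))
        where
        open CycleFacet T tmax∈T tmin∉T using (P-dim; cycleFacet-dim)
        t∉T : t ∉ T
        t∉T = ≢max ∘ ∈T⁻
        t≢tmax : t ≢ tmax
        t≢tmax refl = ≢max refl
        αrt≡αt : α (c (r t)) ≡ α t
        αrt≡αt = cong α (c∘r t)
        F-vanishes : ∀ x → F x → x (r t) ≡ 0ℚ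
        F-vanishes x x∈F = Represents-isolated {w = weights s} (represents s) (r t) outflow≡0 inflow≡0
          where
          x∈P : P x
          x∈P = proj₁ (F⊆ x x∈F)
          s : SEP n x
          s = proj₁ x∈P
          outflow≡0 : ∀ j → weights s (r t) j ≡ 0ℚ
          outflow≡0 j = [ (λ w≡0 → w≡0) ,
                          (λ gap → ⊥-elim (≢max (trans (sym αrt≡αt) (proj₁ (gap≡D⇒extreme {c (r t)} {c j} gap))))) ]′
                          (F-supported x∈F x∈P (r t) j)
          inflow≡0 : ∀ i → weights s i (r t) ≡ 0ℚ
          inflow≡0 i = [ (λ w≡0 → w≡0) ,
                         (λ gap → ⊥-elim (≢min (trans (sym αrt≡αt) (proj₂ (gap≡D⇒extreme {c i} {c (r t)} gap))))) ]′
                         (F-supported x∈F x∈P i (r t))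
        m′≤k : m′ ℕ.≤ k
        m′≤k = ℕ.≤-pred (AffIndPoints-≤-dim {A = P} P-dim′ (proj₁ P-dim))
        qs : AffIndPoints F m′
        qs = AffIndPoints-shrink {A = F} (ℕ.≤⇒≤′ m′≤k) (proj₁ F-dim)
        q : Fin m′ → Point n
        q = proj₁ qs
        q∈F : ∀ i → F (q i)
        q∈F = proj₁ (proj₂ qs)
        q-ind : AffInd q
        q-ind = proj₂ (proj₂ qs)

      outside⇒αmin : ∀ t → t ∉ T → α t ≡ αmin
      outside⇒αmin t t∉T = decidable-stable (α t ℚ.≟ αmin)
                             (noIntermediate t (t∉T ∘ ∈-select⁺ (λ t → α t ℚ.≟ αmax)))

      cycleFacet⊆F : cycleFacet T ⊆ₚ F
      cycleFacet⊆F x (x∈P , 𝐞·x≡1) = ⊆F x (x∈P , trans (a·x≡ā·x x∈P)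
        (trans (supported⇒SEP-≡ {a = ā} {D = D} s λ i j →
                   map₂ averageGap (SEP-≡⇒supported {a = 𝐞[ cycleUnion T ]} {D = 1ℚ}
                                                    (𝐞[]-gap≤1 (cycleUnion T)) s 𝐞·x≡1 i j))
               (sym b≡D)))
        where
        s = proj₁ x∈P
        averageGap : ∀ {i j} → 𝐞[ cycleUnion T ] i - 𝐞[ cycleUnion T ] j ≡ 1ℚ → ā i - ā j ≡ D
        averageGap gap≡1 =
          cong₂ _-_ (∈T⁻ (∈-cycleUnion⁻ T (proj₁ i∈∧j∉))) (outside⇒αmin _ (proj₂ i∈∧j∉ ∘ ∈-cycleUnion⁺ T))
          where i∈∧j∉ = 𝐞[]-gap≡1⇒∈∉ (cycleUnion T) gap≡1

      classification : Σ (Subset m) λ T → NonemptyProper T × F ≐ cycleFacet T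
      classification = T , ((tmax , tmax∈T) , (tmin , tmin∉T)) , (F⊆cycleFacet , cycleFacet⊆F)

    facet-classification : ∀ F → IsFacet P F → Σ (Subset m) λ T → NonemptyProper T × F ≐ cycleFacet T
    facet-classification F ((a , b , valid , F⊆ , ⊆F) , (x₀ , x₀∈F) , (k , P-dim′ , F-dim)) =
      Classify.classification F a b valid F⊆ ⊆F x₀ x₀∈F k P-dim′ F-dim

  module _ {k : ℕ} {a b : Fin (suc (suc k))} (a≢b : a ≢ b) where

    private
      b′ : Fin (suc k)
      b′ = punchOut a≢b

    skip₂ : Fin k → Fin (suc (suc k))
    skip₂ = punchIn a ∘ punchIn b′

    skip₂-injective : ∀ {i j} → skip₂ i ≡ skip₂ j → i ≡ j
    skip₂-injective {i} {j} = punchIn-injective b′ i j ∘ punchIn-injective a _ _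

    skip₂≢a : ∀ i → skip₂ i ≢ a
    skip₂≢a i = punchInᵢ≢i a (punchIn b′ i)

    skip₂≢b : ∀ i → skip₂ i ≢ b
    skip₂≢b i eq = punchInᵢ≢i b′ i (punchIn-injective a _ _ (trans eq (sym (punchIn-punchOut a≢b))))

    skip₂-surjective : ∀ {x} → x ≢ a → x ≢ b → ∃ λ i → skip₂ i ≡ x
    skip₂-surjective {x} x≢a x≢b = punchOut b′≢y , (begin
      punchIn a (punchIn b′ (punchOut b′≢y))  ≡⟨ cong (punchIn a) (punchIn-punchOut b′≢y) ⟩
      punchIn a y                              ≡⟨ punchIn-punchOut (x≢a ∘ sym) ⟩
      x                                        ∎)
      where
      open ≡-Reasoning
      y : Fin (suc k)
      y = punchOut (x≢a ∘ sym)
      b′≢y : b′ ≢ y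
      b′≢y b′≡y = x≢b (punchOut-injective (x≢a ∘ sym) a≢b (sym b′≡y))

  funToFin-cong : ∀ {m n} {f g : Fin m → Fin n} → (∀ i → f i ≡ g i) → funToFin f ≡ funToFin g
  funToFin-cong {zero}  _   = refl
  funToFin-cong {suc m} f≗g = cong₂ combine (f≗g zero) (funToFin-cong (f≗g ∘ suc))

  module _ {m : ℕ} where
    open Inverse 2↔Bool using (to; from; strictlyInverseˡ; strictlyInverseʳ)

    encode : Subset m → Fin (2 ^ m)
    encode T = funToFin (from ∘ lookup T)

    decode : Fin (2 ^ m) → Subset m
    decode x = tabulate (to ∘ finToFun x)

    decode∘encode : ∀ T → decode (encode T) ≡ T
    decode∘encode T =
      trans (tabulate-cong λ t → trans (cong to (finToFun-funToFin (from ∘ lookup T) t)) (strictlyInverseˡ (lookup T t)))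
            (tabulate∘lookup T)

    encode∘decode : ∀ x → encode (decode x) ≡ x
    encode∘decode x =
      trans (funToFin-cong λ t → trans (cong from (lookup∘tabulate (to ∘ finToFun {2} {m} x) t))
                                       (strictlyInverseʳ (finToFun x t)))
            (funToFin-finToFin {m} {2} x)

  module Enumeration {m′ k : ℕ} (enc : Subset (suc m′) → Fin (suc (suc k))) (dec : Fin (suc (suc k)) → Subset (suc m′))
                     (dec∘enc : ∀ T → dec (enc T) ≡ T) (enc∘dec : ∀ x → enc (dec x) ≡ x) where

    enc-injective : ∀ {T T′} → enc T ≡ enc T′ → T ≡ T′
    enc-injective {T} {T′} eq = trans (sym (dec∘enc T)) (trans (cong dec eq) (dec∘enc T′))

    enc∅≢encFull : enc ∅ ≢ enc full
    enc∅≢encFull eq = ∉⊥ (subst (zero ∈_) (sym (enc-injective eq)) ∈⊤)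

    index : Fin k → Subset (suc m′)
    index = dec ∘ skip₂ enc∅≢encFull

    index-injective : ∀ i j → index i ≡ index j → i ≡ j
    index-injective i j eq = skip₂-injective enc∅≢encFull (trans (sym (enc∘dec _)) (trans (cong enc eq) (enc∘dec _)))

    index-nonemptyProper : ∀ i → NonemptyProper (index i)
    index-nonemptyProper i = decidable-stable (nonempty? T) ¬empty , decidable-stable (any? (λ t → ¬? (t ∈? T))) ¬full
      where
      T = index i
      enc-T : enc T ≡ skip₂ enc∅≢encFull i
      enc-T = enc∘dec _
      ¬empty : ¬ ¬ ∃ (_∈ T)
      ¬empty empty = skip₂≢a enc∅≢encFull i (trans (sym enc-T) (cong enc (Empty-unique empty)))
      ¬full : ¬ ¬ ∃ (_∉ T)
      ¬full ∄ = skip₂≢b enc∅≢encFull i (trans (sym enc-T) (cong enc (⊆-antisym (⊆-max T) λ {t} _ →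
                  decidable-stable (t ∈? T) (∄ ∘ (t ,_)))))

    index-surjective : ∀ T → NonemptyProper T → ∃ λ i → index i ≡ T
    index-surjective T ((t , t∈T) , (s , s∉T)) =
      proj₁ preimage , trans (cong dec (proj₂ preimage)) (dec∘enc T)
      where
      preimage : ∃ λ i → skip₂ enc∅≢encFull i ≡ enc T
      preimage = skip₂-surjective enc∅≢encFull
        (λ eq → ∉⊥ (subst (t ∈_) (enc-injective eq) t∈T))
        (λ eq → s∉T (subst (s ∈_) (sym (enc-injective eq)) ∈⊤))

  module NonemptyProperSubsets (m′ : ℕ) where

    2^m≡2+[2^m∸2] : 2 ^ suc m′ ≡ 2 ℕ.+ (2 ^ suc m′ ∸ 2)
    2^m≡2+[2^m∸2] = sym (ℕ.m+[n∸m]≡n (ℕ.*-monoʳ-≤ 2 (ℕ.m^n>0 2 m′)))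

    private
      k : ℕ
      k = 2 ^ suc m′ ∸ 2

      enc : Subset (suc m′) → Fin (suc (suc k))
      enc = cast 2^m≡2+[2^m∸2] ∘ encode

      dec : Fin (suc (suc k)) → Subset (suc m′)
      dec = decode ∘ cast (sym 2^m≡2+[2^m∸2])

      dec∘enc : ∀ T → dec (enc T) ≡ T
      dec∘enc T = trans (cong decode (cast-involutive (sym 2^m≡2+[2^m∸2]) 2^m≡2+[2^m∸2] (encode T))) (decode∘encode {suc m′} T)

      enc∘dec : ∀ x → enc (dec x) ≡ x
      enc∘dec x = trans (cong (cast 2^m≡2+[2^m∸2]) (encode∘decode {suc m′} (cast (sym 2^m≡2+[2^m∸2]) x)))
                        (cast-involutive 2^m≡2+[2^m∸2] (sym 2^m≡2+[2^m∸2]) x)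

    open Enumeration enc dec dec∘enc enc∘dec public using (index; index-injective; index-nonemptyProper; index-surjective)

open import Data.Nat using (ℕ; _≤_; _^_; _∸_; s≤s; zero; suc)
open import Data.Fin using (Fin; zero)
open import Data.Fin.Properties using (¬Fin0)
open import Data.Fin.Subset using (Subset)
open import Data.Fin.Permutation using (Permutation′)
open import Data.Product using (Σ; ∃; _×_; _,_; proj₁)
open import Data.Empty using (⊥-elim)
open import Function using (_∘_)
open import Relation.Binary.PropositionalEquality using (_≡_; subst; sym)

theorem5p7 : (n : ℕ) → 2 ≤ n → (σ : Permutation′ n) →
    (m : ℕ) → (c : Fin n → Fin m) → IsCycleDecomp σ c →
    (Σ (Fin (2 ^ m ∸ 2) → PSet n) λ f →
        (∀ i → IsFacet (Fixed σ (SEP n)) (f i))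
      × (∀ i j → f i ≐ f j → i ≡ j)
      × (∀ F → IsFacet (Fixed σ (SEP n)) F → ∃ λ i → F ≐ f i))
    × (Σ ((F : PSet n) → IsFacet (Fixed σ (SEP n)) F → Subset n) λ lab →
        (∀ F (p : IsFacet (Fixed σ (SEP n)) F) →
            NonemptyProper (lab F p) × CycleUnion c (lab F p)
          × (F ⊆ₚ SEPFacet n (lab F p)))
      × (∀ F p G q → lab F p ≡ lab G q → F ≐ G))
theorem5p7 _ (s≤s _) σ zero     c cd = ⊥-elim (¬Fin0 (c zero))
theorem5p7 n _       σ (suc m′) c cd =
  (cycleFacet ∘ index , cycleFacet-isFacet ∘ index-nonemptyProper , facet-injective , facet-surjective) ,
  (label , label-spec , label-injective)
  where
  open FixedPolytope σ c cd
  open FacetClassification σ c cd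
  open NonemptyProperSubsets m′

  facet-injective : ∀ i j → cycleFacet (index i) ≐ cycleFacet (index j) → i ≡ j
  facet-injective i j = index-injective i j ∘ cycleFacet-injective (index-nonemptyProper i) (index-nonemptyProper j)

  facet-surjective : ∀ F → IsFacet P F → ∃ λ i → F ≐ cycleFacet (index i)
  facet-surjective F F-facet =
    let (T , T-np , F≐T) = facet-classification F F-facet
        (i , index-i≡T)  = index-surjective T T-np
    in i , subst (λ T′ → F ≐ cycleFacet T′) (sym index-i≡T) F≐T

  label : (F : PSet n) → IsFacet P F → Subset n
  label F F-facet = cycleUnion (proj₁ (facet-classification F F-facet))

  label-spec : ∀ F (F-facet : IsFacet P F) →
    NonemptyProper (label F F-facet) × CycleUnion c (label F F-facet) × (F ⊆ₚ SEPFacet n (label F F-facet))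
  label-spec F F-facet =
    let (T , T-np , F⊆T , _) = facet-classification F F-facet
    in cycleUnion-nonemptyProper T-np , cycleUnion-isCycleUnion T , λ x → cycleFacet⊆SEPFacet T x ∘ F⊆T x

  label-injective : ∀ F F-facet G G-facet → label F F-facet ≡ label G G-facet → F ≐ G
  label-injective F F-facet G G-facet eq =
    let (T , _ , F≐T)  = facet-classification F F-facet
        (T′ , _ , G≐T′) = facet-classification G G-facet
    in ≐-trans F≐T (≐-trans (cycleFacet-cong {T} {T′} eq) (≐-sym G≐T′))
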